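{- Let $S$ be a signed digraph of order $n$. Then the following statements are equivalent. (I) The spectrum of $S$ (the multiset of eigenvalues of its adjacency matrix) is invariant under multiplication by $-1$. (II) $S$ and $-S$ are cospectral. (III) For each odd $j$, the number of linear subsidigraphs of $S$ of order $j$ that are of type $a$ or of type $b$ equals the number of linear subsidigraphs of $S$ of order $j$ that are of type $c$ or of type $d$.
   Context: A signed digraph (sidigraph) $S=(D,\sigma)$ consists of a digraph $D=(V,\mathscr{A})$ (no loops or multiple arcs) and a sign function $\sigma:\mathscr{A}\to\{ -1,1\}$. Its adjacency matrix $A(S)=(a_{ij})$ has $a_{ij}=\sigma(v_i,v_j)$ if there is an arc from $v_i$ to $v_j$ and $a_{ij}=0$ otherwise; the eigenvalues/spectrum of $S$ are those of $A(S)$, and two sidigraphs are cospectral if they have the same spectrum. $-S$ denotes the sidigraph obtained from $S$ by negating the sign of every arc. A linear subsidigraph of $S$ is a subsidigraph in which every vertex has indegree and outdegree one, i.e. a vertex-disjoint union of directed cycles; its order is its number of vertices. For a linear subsidigraph $L$, let $p(L)$ be its number of components (cycles) and $s(L)$ the product of the signs of its cycles, where the sign of a cycle is the product of the signs of its arcs. $L$ is of type $a$ if $p(L)$ is odd and $s(L)<0$; of type $b$ if $p(L)$ is even and $s(L)>0$; of type $c$ if $p(L)$ is odd and $s(L)>0$; of type $d$ if $p(L)$ is even and $s(L)<0$. -}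

module Defs where

open import Data.Nat as ℕ using (ℕ; zero; suc; _∸_; _%_; _≡ᵇ_; _≤ᵇ_)
open import Data.Integer as ℤ using (ℤ; +_; -_; _^_)
open import Data.Fin using (Fin; zero; suc; punchIn; toℕ; _≟_)
open import Data.List as List using (List; []; _∷_; length; filterᵇ; concatMap; allFin)
open import Data.Maybe as Maybe using (Maybe; nothing; just; is-just; _>>=_)
open import Data.Bool using (Bool; true; false; _∧_; _∨_; not; if_then_else_)
open import Data.Sign as Sign using (Sign)
open import Relation.Nullary using (does)
open import Relation.Binary.PropositionalEquality using (_≡_; cong)

-- Signed digraphs on vertex set Fin n (no loops, no multiple arcs):
-- arc i j = nothing  : no arc from v_i to v_j
-- arc i j = just s   : an arc from v_i to v_j with sign s

record SignedDigraph (n : ℕ) : Set where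
  field
    arc      : Fin n → Fin n → Maybe Sign
    loopless : ∀ i → arc i i ≡ nothing
open SignedDigraph public

negSD : ∀ {n} → SignedDigraph n → SignedDigraph n
negSD S = record
  { arc      = λ i j → Maybe.map Sign.opposite (arc S i j)
  ; loopless = λ i → cong (Maybe.map Sign.opposite) (loopless S i) }

signℤ : Sign → ℤ
signℤ Sign.+ = + 1
signℤ Sign.- = - (+ 1)

adj : ∀ {n} → SignedDigraph n → Fin n → Fin n → ℤ
adj S i j with arc S i j
... | nothing = + 0
... | just s  = signℤ s

-- Polynomials over ℤ as coefficient sequences (p k = coefficient of x^k)

Poly : Set
Poly = ℕ → ℤ

sumTo : ℕ → (ℕ → ℤ) → ℤ
sumTo zero    f = + 0
sumTo (suc k) f = sumTo k f ℤ.+ f k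

pconst : ℤ → Poly
pconst c zero    = c
pconst c (suc _) = + 0

pX : Poly
pX 1 = + 1
pX _ = + 0

padd : Poly → Poly → Poly
padd p q k = p k ℤ.+ q k

pscale : ℤ → Poly → Poly
pscale c p k = c ℤ.* p k

pmul : Poly → Poly → Poly
pmul p q k = sumTo (suc k) (λ i → p i ℤ.* q (k ∸ i))

psumFin : ∀ {n} → (Fin n → Poly) → Poly
psumFin {zero}  f = pconst (+ 0)
psumFin {suc n} f = padd (f zero) (psumFin (λ i → f (suc i)))

det : ∀ n → (Fin n → Fin n → Poly) → Poly
det zero    M = pconst (+ 1)
det (suc n) M = psumFin λ j →
  pmul (pscale ((- (+ 1)) ^ toℕ j) (M zero j))
       (det n (λ i k → M (suc i) (punchIn j k)))

charPoly : ∀ {n} → SignedDigraph n → Poly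
charPoly {n} S = det n λ i j →
  padd (if does (i ≟ j) then pX else pconst (+ 0)) (pconst (- adj S i j))

-- S and T cospectral: same characteristic polynomial
-- (equivalently, the same multiset of complex eigenvalues)
Cospectral : ∀ {n} → SignedDigraph n → SignedDigraph n → Set
Cospectral S T = ∀ k → charPoly S k ≡ charPoly T k

-- The spectrum of S is invariant under λ ↦ -λ:
-- the multiset of roots of χ(x) equals the multiset of roots of
-- (-1)^n χ(-x) (the monic polynomial whose roots are the negated eigenvalues),
-- i.e. χ(x) = (-1)^n χ(-x) coefficientwise.
SpectrumSymmetric : ∀ {n} → SignedDigraph n → Set
SpectrumSymmetric {n} S =
  ∀ k → charPoly S k ≡ ((- (+ 1)) ^ n) ℤ.* (((- (+ 1)) ^ k) ℤ.* charPoly S k)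

-- A linear subsidigraph L is encoded by the map f : Fin n → Maybe (Fin n)
-- with  f v = just w  iff  v ∈ V(L) and (v,w) is the (unique) out-arc of v in L,
-- and   f v = nothing iff  v ∉ V(L).
-- This encoding is a bijection between linear subsidigraphs and maps f such that
-- (isLinear) for every v with f v = just w: w ∈ V(L), (v,w) is an arc of S,
-- and v is the only vertex mapped to w (indegree one).

PMap : ℕ → Set
PMap n = Fin n → Maybe (Fin n)

consF : ∀ {m n} → Maybe (Fin n) → (Fin m → Maybe (Fin n)) → Fin (suc m) → Maybe (Fin n)
consF o f zero    = o
consF o f (suc i) = f i

allMaps : ∀ m n → List (Fin m → Maybe (Fin n))
allMaps zero    n = (λ ()) ∷ []
allMaps (suc m) n =
  concatMap (λ o → List.map (consF o) (allMaps m n)) (nothing ∷ List.map just (allFin n))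

allᵇ : ∀ {A : Set} → (A → Bool) → List A → Bool
allᵇ p []       = true
allᵇ p (x ∷ xs) = p x ∧ allᵇ p xs

allV : ∀ {n} → (Fin n → Bool) → Bool
allV p = allᵇ p (allFin _)

countV : ∀ {n} → (Fin n → Bool) → ℕ
countV p = length (filterᵇ p (allFin _))

eqMaybeFin : ∀ {n} → Maybe (Fin n) → Fin n → Bool
eqMaybeFin nothing  w = false
eqMaybeFin (just u) w = does (u ≟ w)

isLinear : ∀ {n} → SignedDigraph n → PMap n → Bool
isLinear S f = allV λ v → check v (f v)
  where
  check : _ → Maybe _ → Bool
  check v nothing  = true
  check v (just w) =
    is-just (f w) ∧ is-just (arc S v w) ∧ allV (λ u → not (eqMaybeFin (f u) w) ∨ does (u ≟ v))

order : ∀ {n} → PMap n → ℕ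
order f = countV (λ v → is-just (f v))

iter : ∀ {n} → PMap n → ℕ → Maybe (Fin n) → Maybe (Fin n)
iter f zero    x = x
iter f (suc k) x = iter f k x >>= f

isCycleMin : ∀ {n} → PMap n → Fin n → Bool
isCycleMin {n} f v = is-just (f v) ∧ allᵇ ok (List.upTo n)
  where
  ok : ℕ → Bool
  ok k with iter f k (just v)
  ... | nothing = true
  ... | just w  = toℕ v ≤ᵇ toℕ w

-- p(L): number of components (cycles) of L (each cycle counted by its least vertex)
components : ∀ {n} → PMap n → ℕ
components f = countV (isCycleMin f)

-- s(L): product of the signs of the cycles = product of the signs of all arcs of L
arcSign : ∀ {n} → SignedDigraph n → Fin n → Fin n → Sign
arcSign S v w with arc S v w
... | nothing = Sign.+
... | just s  = s

linSign : ∀ {n} → SignedDigraph n → PMap n → Sign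
linSign S f = List.foldr Sign._*_ Sign.+ (List.map g (allFin _))
  where
  g : _ → Sign
  g v with f v
  ... | nothing = Sign.+
  ... | just w  = arcSign S v w

isOddᵇ : ℕ → Bool
isOddᵇ k = k % 2 ≡ᵇ 1

isNeg : Sign → Bool
isNeg Sign.- = true
isNeg Sign.+ = false

typeA typeB typeC typeD : ∀ {n} → SignedDigraph n → PMap n → Bool
typeA S f = isOddᵇ (components f)       ∧ isNeg (linSign S f)
typeB S f = not (isOddᵇ (components f)) ∧ not (isNeg (linSign S f))
typeC S f = isOddᵇ (components f)       ∧ not (isNeg (linSign S f))
typeD S f = not (isOddᵇ (components f)) ∧ isNeg (linSign S f)

countLinear : ∀ {n} → SignedDigraph n → ℕ → (PMap n → Bool) → ℕ
countLinear {n} S j P =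
  length (filterᵇ (λ f → isLinear S f ∧ (order f ≡ᵇ j) ∧ P f) (allMaps n n))

CondIII : ∀ {n} → SignedDigraph n → Set
CondIII S = ∀ j → j % 2 ≡ 1 →
  countLinear S j (λ f → typeA S f ∨ typeB S f)
    ≡ countLinear S j (λ f → typeC S f ∨ typeD S f)

-- Expand det(xI − A) by the Leibniz formula: the coefficient of x^k collects the permutations σ
-- with exactly k fixed points, each weighted by sgn σ times the product of −a(i, σ i) over the
-- points i that σ moves. Such a term vanishes unless the nontrivial cycles of σ form a linear
-- subdigraph L of S, necessarily of order n − k, and then it equals (−1)^p(L) s(L), because
-- sgn σ = (−1)^(n − c(σ)) where c(σ) = p(L) + k is the number of cycles of σ. So the term is +1 for
-- L of type a or b and −1 for L of type c or d, and the coefficient of x^(n−j) is the difference of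
-- the two counts in (III) for order j. Negating every arc multiplies that coefficient by (−1)^j:
-- this is χ₋ₛ(x) = (−1)^n χₛ(−x), giving (I) ⇔ (II), and χ₋ₛ = χₛ holds exactly when the counts
-- agree for every odd j, giving (II) ⇔ (III).
-- The identity sgn σ = (−1)^(n − c(σ)) rests on a transposition changing the parity of c(σ), which
-- is proved by induction on n, splicing the last vertex out of its cycle.

module Submission where

open import Defs
open import Data.Bool using (Bool; true; false; T; _∧_; _∨_; not; if_then_else_)
open import Data.Bool.Properties using (T-≡; T-∧; ¬-not)
import Data.Bool.Properties as Boolₚ
open import Data.Fin as Fin using (Fin; zero; suc; toℕ; fromℕ; inject₁; punchIn; punchOut; _≟_)
import Data.Fin.Properties as Finₚ
open import Data.Integer as ℤ using (ℤ; +_; -_; _+_; _-_; _*_; _^_)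
import Data.Integer.Properties as ℤₚ
open import Data.Integer.Solver using (module +-*-Solver)
open import Data.Maybe using (Maybe; just; nothing; is-just; _>>=_; fromMaybe)
open import Data.Sign as Sign using (Sign)
import Data.Sign.Properties as Signₚ
import Data.Maybe.Properties as Maybeₚ
open import Data.Nat as ℕ using (ℕ; zero; suc; _≤_; _<_; _∸_; _≡ᵇ_; _≤ᵇ_; z≤n; s≤s)
import Data.Nat.Properties as ℕₚ
open import Data.Product using (Σ; _×_; _,_; proj₁; proj₂)
open import Data.Unit using (⊤; tt)
open import Data.List as List using (List; []; _∷_)
open import Data.List.Relation.Unary.All using (All; []; _∷_)
import Data.List.Relation.Unary.All.Properties as Allₚ
open import Function.Definitions using (Injective)
open import Data.Fin.Permutation.Components using (transpose; transpose-inverse)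
open import Relation.Nullary.Decidable using (dec-true; dec-false)
open import Data.Sum using (_⊎_; inj₁; inj₂)
open import Relation.Nullary using (Dec; yes; no; does; ¬_; contradiction)
open import Relation.Binary.PropositionalEquality
open import Function.Base using (_∘_; id)
open import Function.Bundles using (_⇔_; mk⇔; Equivalence)
open import Algebra.Properties.Semiring.Sum ℤₚ.+-*-semiring
  using (sum; sum-cong-≗; sum-replicate-zero; ∑-distrib-+; *-distribˡ-sum)
open import Algebra.Properties.Monoid.Sum ℤₚ.*-1-monoid
  using () renaming (sum to product; sum-cong-≗ to product-cong)

open +-*-Solver using (solve; _:+_; _:-_; _:*_; :-_; _:=_; con)

T-ext : ∀ {a b} → (T a → T b) → (T b → T a) → a ≡ b
T-ext {false} {false} _ _ = refl
T-ext {false} {true}  _ g = contradiction (g _) λ ()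
T-ext {true}  {false} f _ = contradiction (f _) λ ()
T-ext {true}  {true}  _ _ = refl

T⇒≡true : ∀ {b} → T b → b ≡ true
T⇒≡true = Equivalence.to T-≡

¬T⇒≡false : ∀ {b} → ¬ T b → b ≡ false
¬T⇒≡false ¬t = ¬-not (¬t ∘ Equivalence.from T-≡)

does-≡ : ∀ {P Q : Set} (p : Dec P) (q : Dec Q) → (P → Q) → (Q → P) → does p ≡ does q
does-≡ (yes p) (yes q) _ _ = refl
does-≡ (yes p) (no ¬q) f _ = contradiction (f p) ¬q
does-≡ (no ¬p) (yes q) _ g = contradiction (g q) ¬p
does-≡ (no ¬p) (no ¬q) _ _ = refl

∧-false : ∀ {a b} → a ≡ false → a ∧ b ≡ false
∧-false refl = refl

∧-≢ : ∀ a {b c} → a ∧ b ≢ a ∧ c → b ≢ c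
∧-≢ a ne refl = ne refl

allᵇ⇒All : ∀ {A : Set} (p : A → Bool) xs → T (allᵇ p xs) → All (T ∘ p) xs
allᵇ⇒All p []       _ = []
allᵇ⇒All p (x ∷ xs) t = proj₁ (Equivalence.to T-∧ t) ∷ allᵇ⇒All p xs (proj₂ (Equivalence.to T-∧ t))

All⇒allᵇ : ∀ {A : Set} (p : A → Bool) {xs} → All (T ∘ p) xs → T (allᵇ p xs)
All⇒allᵇ p []         = _
All⇒allᵇ p (px ∷ pxs) = Equivalence.from T-∧ (px , All⇒allᵇ p pxs)

allᵇ-cong : ∀ {A : Set} {p q : A → Bool} → (∀ x → p x ≡ q x) → ∀ xs → allᵇ p xs ≡ allᵇ q xs
allᵇ-cong p≗q []       = refl
allᵇ-cong p≗q (x ∷ xs) = cong₂ _∧_ (p≗q x) (allᵇ-cong p≗q xs)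

allᵇ-≢ : ∀ {A : Set} (p q : A → Bool) xs → allᵇ p xs ≢ allᵇ q xs → Σ A λ x → p x ≢ q x
allᵇ-≢ p q []       ne = contradiction refl ne
allᵇ-≢ p q (x ∷ xs) ne with p x Boolₚ.≟ q x
... | no  px≢qx = x , px≢qx
... | yes px≡qx = allᵇ-≢ p q xs (ne ∘ cong₂ _∧_ px≡qx)

allᵇ≡false : ∀ {A : Set} (p : A → Bool) xs → allᵇ p xs ≡ false → Σ A λ x → p x ≡ false
allᵇ≡false p (x ∷ xs) eq with p x in px
... | false = x , px
... | true  = allᵇ≡false p xs eq

foldr-map-≢ : ∀ {A : Set} (g h : A → Sign) xs →
  List.foldr Sign._*_ Sign.+ (List.map g xs) ≢ List.foldr Sign._*_ Sign.+ (List.map h xs) → Σ A λ x → g x ≢ h x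
foldr-map-≢ g h []       ne = contradiction refl ne
foldr-map-≢ g h (x ∷ xs) ne with g x Signₚ.≟ h x
... | no  gx≢hx = x , gx≢hx
... | yes gx≡hx = foldr-map-≢ g h xs (ne ∘ cong₂ Sign._*_ gx≡hx)

bit : Bool → ℕ
bit b = if b then 1 else 0

count : ∀ {n} → (Fin n → Bool) → ℕ
count {zero}  b = 0
count {suc n} b = if b zero then suc (count (b ∘ suc)) else count (b ∘ suc)

count-cong : ∀ {n} {b c : Fin n → Bool} → (∀ i → b i ≡ c i) → count b ≡ count c
count-cong {zero}  b≗c = refl
count-cong {suc n} {b} {c} b≗c rewrite b≗c zero with c zero
... | true  = cong suc (count-cong (b≗c ∘ suc))
... | false = count-cong (b≗c ∘ suc)

count-last : ∀ {m} (b : Fin (suc m) → Bool) → count b ≡ count (b ∘ inject₁) ℕ.+ bit (b (fromℕ m))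
count-last {zero}  b with b zero
... | true  = refl
... | false = refl
count-last {suc m} b with b zero
... | true  = cong suc (count-last (b ∘ suc))
... | false = count-last (b ∘ suc)

count-not : ∀ {n} (b : Fin n → Bool) → count (not ∘ b) ℕ.+ count b ≡ n
count-not {zero}  b = refl
count-not {suc n} b with b zero
... | true  = trans (ℕₚ.+-suc _ _) (cong suc (count-not (b ∘ suc)))
... | false = cong suc (count-not (b ∘ suc))

count-split : ∀ {n} (b m : Fin n → Bool) → (∀ i → b i ≡ true → m i ≡ true) →
  count (λ i → not (b i) ∧ m i) ℕ.+ count b ≡ count m
count-split {zero}  b m b⇒m = refl
count-split {suc n} b m b⇒m with b zero in b₀ | m zero in m₀
... | true  | true  = trans (ℕₚ.+-suc _ _) (cong suc (count-split (b ∘ suc) (m ∘ suc) (b⇒m ∘ suc)))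
... | true  | false = contradiction (trans (sym (b⇒m zero b₀)) m₀) λ ()
... | false | true  = cong suc (count-split (b ∘ suc) (m ∘ suc) (b⇒m ∘ suc))
... | false | false = count-split (b ∘ suc) (m ∘ suc) (b⇒m ∘ suc)

count≤ : ∀ {n} (b : Fin n → Bool) → count b ≤ n
count≤ {zero}  b = z≤n
count≤ {suc n} b with b zero
... | true  = s≤s (count≤ (b ∘ suc))
... | false = ℕₚ.m≤n⇒m≤1+n (count≤ (b ∘ suc))

count-tabulate : ∀ {A : Set} {n} (p : A → Bool) (h : Fin n → A) → List.length (List.filterᵇ p (List.tabulate h)) ≡ count (p ∘ h)
count-tabulate {n = zero}  p h = refl
count-tabulate {n = suc n} p h with p (h zero)
... | true  = cong suc (count-tabulate p (h ∘ suc))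
... | false = count-tabulate p (h ∘ suc)

countV≡count : ∀ {n} (p : Fin n → Bool) → countV p ≡ count p
countV≡count p = count-tabulate p id

≡ᵇ-shift : ∀ {a b n} k → a ℕ.+ b ≡ n → (b ≡ᵇ k) ≡ (a ℕ.+ k ≡ᵇ n)
≡ᵇ-shift {a} {b} {n} k a+b≡n = T-ext
  (λ t → ℕₚ.≡⇒≡ᵇ (a ℕ.+ k) n (trans (cong (a ℕ.+_) (sym (ℕₚ.≡ᵇ⇒≡ b k t))) a+b≡n))
  (λ t → ℕₚ.≡⇒≡ᵇ b k (ℕₚ.+-cancelˡ-≡ a b k (trans a+b≡n (sym (ℕₚ.≡ᵇ⇒≡ (a ℕ.+ k) n t)))))

≡ᵇ-+-cancel : ∀ m {j k n} → j ℕ.+ k ≡ n → (m ℕ.+ k ≡ᵇ n) ≡ (m ≡ᵇ j)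
≡ᵇ-+-cancel m {j} {k} {n} j+k≡n = T-ext
  (λ t → ℕₚ.≡⇒≡ᵇ m j (ℕₚ.+-cancelʳ-≡ k m j (trans (ℕₚ.≡ᵇ⇒≡ (m ℕ.+ k) n t) (sym j+k≡n))))
  (λ t → ℕₚ.≡⇒≡ᵇ (m ℕ.+ k) n (trans (cong (ℕ._+ k) (ℕₚ.≡ᵇ⇒≡ m j t)) j+k≡n))

-1^ : ℕ → ℤ
-1^ m = (- (+ 1)) ^ m

-1^-+ : ∀ a b → -1^ (a ℕ.+ b) ≡ -1^ a * -1^ b
-1^-+ = ℤₚ.^-distribˡ-+-* (- (+ 1))

-1^-square : ∀ m → -1^ m * -1^ m ≡ + 1
-1^-square zero    = refl
-1^-square (suc m) = trans (solve 1 (λ x → (:- con (+ 1) :* x) :* (:- con (+ 1) :* x) := x :* x) refl (-1^ m))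
                           (-1^-square m)

-1^-parity : ∀ m → -1^ m ≡ (if isOddᵇ m then - (+ 1) else + 1)
-1^-parity zero          = refl
-1^-parity (suc zero)    = refl
-1^-parity (suc (suc m)) = trans (solve 1 (λ x → :- con (+ 1) :* (:- con (+ 1) :* x) := x) refl (-1^ m)) (-1^-parity m)

-1^-odd : ∀ j → j ℕ.% 2 ≡ 1 → -1^ j ≡ - (+ 1)
-1^-odd j odd = trans (-1^-parity j) (cong (λ b → if b then - (+ 1) else + 1) (cong (_≡ᵇ 1) odd))

-1^-even : ∀ j → j ℕ.% 2 ≢ 1 → -1^ j ≡ + 1
-1^-even j even = trans (-1^-parity j) (cong (λ b → if b then - (+ 1) else + 1) (¬T⇒≡false (even ∘ ℕₚ.≡ᵇ⇒≡ _ 1)))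

-1^-bit-not : ∀ b → -1^ (bit (not b)) ≡ - -1^ (bit b)
-1^-bit-not true  = refl
-1^-bit-not false = refl

x≡-x⇒x≡0 : ∀ (x : ℤ) → x ≡ - x → x ≡ + 0
x≡-x⇒x≡0 (+ zero)   _ = refl
x≡-x⇒x≡0 (+ suc m)  ()
x≡-x⇒x≡0 ℤ.-[1+ m ] ()

signℤ-* : ∀ s t → signℤ (s Sign.* t) ≡ signℤ s * signℤ t
signℤ-* Sign.+ Sign.+ = refl
signℤ-* Sign.+ Sign.- = refl
signℤ-* Sign.- Sign.+ = refl
signℤ-* Sign.- Sign.- = refl

signℤ-isNeg : ∀ s → signℤ s ≡ (if isNeg s then - (+ 1) else + 1)
signℤ-isNeg Sign.+ = refl
signℤ-isNeg Sign.- = refl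

signℤ-foldr : ∀ {A : Set} (g : A → Sign) {n} (h : Fin n → A) →
  signℤ (List.foldr Sign._*_ Sign.+ (List.map g (List.tabulate h))) ≡ product (λ i → signℤ (g (h i)))
signℤ-foldr g {zero}  h = refl
signℤ-foldr g {suc n} h = trans (signℤ-* (g (h zero)) _) (cong (signℤ (g (h zero)) *_) (signℤ-foldr g (h ∘ suc)))

when : Bool → ℤ → ℤ
when b x = if b then x else + 0

when-zero : ∀ b → when b (+ 0) ≡ + 0
when-zero true  = refl
when-zero false = refl

when-∧ : ∀ a b x → when (a ∧ b) x ≡ when a (when b x)
when-∧ true  b x = refl
when-∧ false b x = refl

when-* : ∀ a b x → when a x * when b (+ 1) ≡ when (a ∧ b) x
when-* true  true  x = ℤₚ.*-identityʳ x
when-* true  false x = ℤₚ.*-zeroʳ x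
when-* false b     x = refl

product-zero : ∀ {n} (g : Fin n → ℤ) i → g i ≡ + 0 → product g ≡ + 0
product-zero g zero    gᵢ≡0 = cong (_* product (g ∘ suc)) gᵢ≡0
product-zero g (suc i) gᵢ≡0 = trans (cong (g zero *_) (product-zero (g ∘ suc) i gᵢ≡0)) (ℤₚ.*-zeroʳ (g zero))

infix 4 _≈_
_≈_ : Poly → Poly → Set
p ≈ q = ∀ k → p k ≡ q k

sumTo-cong : ∀ k {f g : ℕ → ℤ} → (∀ i → f i ≡ g i) → sumTo k f ≡ sumTo k g
sumTo-cong zero    f≗g = refl
sumTo-cong (suc k) f≗g = cong₂ _+_ (sumTo-cong k f≗g) (f≗g k)

sumTo-zero : ∀ k {f : ℕ → ℤ} → (∀ i → f i ≡ + 0) → sumTo k f ≡ + 0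
sumTo-zero zero    f≗0 = refl
sumTo-zero (suc k) f≗0 = cong₂ _+_ (sumTo-zero k f≗0) (f≗0 k)

sumTo-head : ∀ k (f : ℕ → ℤ) → sumTo (suc k) f ≡ f 0 + sumTo k (λ i → f (suc i))
sumTo-head zero    f = trans (ℤₚ.+-identityˡ (f 0)) (sym (ℤₚ.+-identityʳ (f 0)))
sumTo-head (suc k) f = trans (cong (_+ f (suc k)) (sumTo-head k f)) (ℤₚ.+-assoc (f 0) _ _)

sumTo-sum-comm : ∀ k {n} (f : ℕ → Fin n → ℤ) → sumTo k (λ i → sum (f i)) ≡ sum (λ j → sumTo k (λ i → f i j))
sumTo-sum-comm zero    {n} f = sym (sum-replicate-zero n)
sumTo-sum-comm (suc k)     f = trans (cong (_+ sum (f k)) (sumTo-sum-comm k f)) (sym (∑-distrib-+ _ (f k)))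

pmul-congʳ : ∀ p {q r} → q ≈ r → pmul p q ≈ pmul p r
pmul-congʳ p q≈r k = sumTo-cong (suc k) (λ i → cong (p i *_) (q≈r (k ∸ i)))

pmul-congˡ : ∀ {p q} r → p ≈ q → pmul p r ≈ pmul q r
pmul-congˡ r p≈q k = sumTo-cong (suc k) (λ i → cong (_* r (k ∸ i)) (p≈q i))

pmul-distribˡ-sum : ∀ {n} p (F : Fin n → Poly) → pmul p (λ k → sum (λ j → F j k)) ≈ λ k → sum (λ j → pmul p (F j) k)
pmul-distribˡ-sum p F k = trans (sumTo-cong (suc k) (λ i → *-distribˡ-sum (p i) (λ j → F j (k ∸ i))))
                       (sumTo-sum-comm (suc k) (λ i j → p i * F j (k ∸ i)))

pmul-pscale : ∀ a b p q → pmul (pscale a p) (pscale b q) ≈ pscale (a * b) (pmul p q)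
pmul-pscale a b p q k = trans (sumTo-cong (suc k) (λ i → regroup (p i) (q (k ∸ i)))) (scale-out (suc k))
  where
  regroup : ∀ x y → (a * x) * (b * y) ≡ (a * b) * (x * y)
  regroup = solve 4 (λ a b x y → (a :* x) :* (b :* y) := (a :* b) :* (x :* y)) refl a b
  scale-out : ∀ m → sumTo m (λ i → (a * b) * (p i * q (k ∸ i))) ≡ (a * b) * sumTo m (λ i → p i * q (k ∸ i))
  scale-out zero    = sym (ℤₚ.*-zeroʳ (a * b))
  scale-out (suc m) = trans (cong₂ _+_ (scale-out m) refl) (sym (ℤₚ.*-distribˡ-+ (a * b) _ _))

psumFin-coeff : ∀ {n} (f : Fin n → Poly) → psumFin f ≈ λ k → sum (λ j → f j k)
psumFin-coeff {zero}  f zero    = refl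
psumFin-coeff {zero}  f (suc k) = refl
psumFin-coeff {suc n} f k       = cong (λ t → f zero k + t) (psumFin-coeff (f ∘ suc) k)

pconst-zero : ∀ k → pconst (+ 0) k ≡ + 0
pconst-zero zero    = refl
pconst-zero (suc k) = refl

monomial : ℕ → Poly
monomial m k = when (m ≡ᵇ k) (+ 1)

monomial-diagonal : ∀ m → monomial m m ≡ + 1
monomial-diagonal zero    = refl
monomial-diagonal (suc m) = monomial-diagonal m

monomial-off-diagonal : ∀ {m k} → m ≢ k → monomial m k ≡ + 0
monomial-off-diagonal {m} {k} m≢k with m ≡ᵇ k in eq
... | true  = contradiction (ℕₚ.≡ᵇ⇒≡ m k (Equivalence.from T-≡ eq)) m≢k
... | false = refl

shift : Poly → Poly
shift q zero    = + 0
shift q (suc k) = q k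

pmul-pX : ∀ q → pmul pX q ≈ shift q
pmul-pX q zero    = refl
pmul-pX q (suc k) = begin
  sumTo (suc (suc k)) (λ i → pX i * q (suc k ∸ i))
    ≡⟨ sumTo-head (suc k) _ ⟩
  + 0 + sumTo (suc k) (λ i → pX (suc i) * q (k ∸ i))
    ≡⟨ ℤₚ.+-identityˡ _ ⟩
  sumTo (suc k) (λ i → pX (suc i) * q (k ∸ i))
    ≡⟨ sumTo-head k _ ⟩
  + 1 * q k + sumTo k (λ i → pX (suc (suc i)) * q (k ∸ suc i))
    ≡⟨ cong₂ _+_ (ℤₚ.*-identityˡ (q k)) (sumTo-zero k (λ _ → refl)) ⟩
  q k + + 0
    ≡⟨ ℤₚ.+-identityʳ (q k) ⟩
  q k ∎
  where open ≡-Reasoning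

pmul-pconst : ∀ c q → pmul (pconst c) q ≈ pscale c q
pmul-pconst c q k = begin
  sumTo (suc k) (λ i → pconst c i * q (k ∸ i))                   ≡⟨ sumTo-head k _ ⟩
  c * q k + sumTo k (λ i → pconst c (suc i) * q (k ∸ suc i))     ≡⟨ cong (λ t → c * q k + t) (sumTo-zero k (λ _ → refl)) ⟩
  c * q k + + 0                                                  ≡⟨ ℤₚ.+-identityʳ _ ⟩
  c * q k                                                        ∎
  where open ≡-Reasoning

shift-monomial : ∀ a m → shift (pscale a (monomial m)) ≈ pscale a (monomial (suc m))
shift-monomial a m zero    = sym (ℤₚ.*-zeroʳ a)
shift-monomial a m (suc k) = refl

-- The Leibniz expansion of the determinant

-- A code (j , c) picks column j in the first row of the Laplace expansion of det and then
-- continues with the code c of the minor; perm follows these choices back to a permutation.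
Code : ℕ → Set
Code zero    = ⊤
Code (suc n) = Fin (suc n) × Code n

perm : ∀ {n} → Code n → Fin n → Fin n
perm (j , c) zero    = j
perm (j , c) (suc i) = punchIn j (perm c i)

codeSign : ∀ {n} → Code n → ℤ
codeSign {zero}  _       = + 1
codeSign {suc n} (j , c) = -1^ (toℕ j) * codeSign c

sum-zero : ∀ {n} (g : Fin n → ℤ) → (∀ j → g j ≡ + 0) → sum g ≡ + 0
sum-zero {n} g g≗0 = trans (sum-cong-≗ g≗0) (sum-replicate-zero n)

sum-single : ∀ {n} (g : Fin n → ℤ) j₀ → (∀ j → j ≢ j₀ → g j ≡ + 0) → sum g ≡ g j₀
sum-single g zero     g≗0 = trans (cong (λ t → g zero + t) (sum-zero (g ∘ suc) λ j → g≗0 (suc j) λ ())) (ℤₚ.+-identityʳ _)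
sum-single g (suc j₀) g≗0 =
  trans (cong₂ _+_ (g≗0 zero λ ()) (sum-single (g ∘ suc) j₀ λ j j≢j₀ → g≗0 (suc j) (j≢j₀ ∘ Finₚ.suc-injective)))
        (ℤₚ.+-identityˡ _)

∑Code : ∀ {n} → (Code n → ℤ) → ℤ
∑Code {zero}  F = F tt
∑Code {suc n} F = sum λ j → ∑Code λ c → F (j , c)

∑Code-cong : ∀ {n} {F G : Code n → ℤ} → (∀ c → F c ≡ G c) → ∑Code F ≡ ∑Code G
∑Code-cong {zero}  F≗G = F≗G tt
∑Code-cong {suc n} F≗G = sum-cong-≗ λ j → ∑Code-cong λ c → F≗G (j , c)

∑Code-scale : ∀ {n} a (F : Code n → ℤ) → ∑Code (λ c → a * F c) ≡ a * ∑Code F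
∑Code-scale {zero}  a F = refl
∑Code-scale {suc n} a F =
  trans (sum-cong-≗ λ j → ∑Code-scale a (λ c → F (j , c))) (sym (*-distribˡ-sum a (λ j → ∑Code (λ c → F (j , c)))))

∑Code-zero : ∀ {n} (G : Code n → ℤ) → (∀ c → G c ≡ + 0) → ∑Code G ≡ + 0
∑Code-zero {zero}  G G≗0 = G≗0 tt
∑Code-zero {suc n} G G≗0 = sum-zero _ λ j → ∑Code-zero (λ c → G (j , c)) λ c → G≗0 (j , c)

∑Code-single : ∀ {n} (G : Code n → ℤ) c₀ → (∀ c → c ≢ c₀ → G c ≡ + 0) → ∑Code G ≡ G c₀
∑Code-single {zero}  G tt       G≗0 = refl
∑Code-single {suc n} G (j₀ , c₀) G≗0 =
  trans (sum-single _ j₀ λ j j≢j₀ → ∑Code-zero (λ c → G (j , c)) λ c → G≗0 (j , c) (j≢j₀ ∘ cong proj₁))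
        (∑Code-single (λ c → G (j₀ , c)) c₀ λ c c≢c₀ → G≗0 (j₀ , c) (c≢c₀ ∘ cong proj₂))

∑Code-distrib-+ : ∀ {n} (F G : Code n → ℤ) → ∑Code (λ c → F c + G c) ≡ ∑Code F + ∑Code G
∑Code-distrib-+ {zero}  F G = refl
∑Code-distrib-+ {suc n} F G = trans (sum-cong-≗ λ j → ∑Code-distrib-+ (λ c → F (j , c)) (λ c → G (j , c)))
                            (∑-distrib-+ (λ j → ∑Code (λ c → F (j , c))) (λ j → ∑Code (λ c → G (j , c))))

pmul-distribˡ-∑Code : ∀ {n} p (F : Code n → Poly) →
  pmul p (λ k → ∑Code (λ c → F c k)) ≈ λ k → ∑Code (λ c → pmul p (F c) k)
pmul-distribˡ-∑Code {zero}  p F k = refl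
pmul-distribˡ-∑Code {suc n} p F k =
  trans (pmul-distribˡ-sum p (λ j k → ∑Code (λ c → F (j , c) k)) k)
        (sum-cong-≗ λ j → pmul-distribˡ-∑Code p (λ c → F (j , c)) k)

pprodFin : ∀ {n} → (Fin n → Poly) → Poly
pprodFin {zero}  h = pconst (+ 1)
pprodFin {suc n} h = pmul (h zero) (pprodFin (h ∘ suc))

det-leibniz : ∀ n (M : Fin n → Fin n → Poly) →
  det n M ≈ λ k → ∑Code (λ c → codeSign c * pprodFin (λ i → M i (perm c i)) k)
det-leibniz zero    M k = sym (ℤₚ.*-identityˡ _)
det-leibniz (suc n) M k = begin
  det (suc n) M k
    ≡⟨ psumFin-coeff (λ j → pmul (row j) (det n (minor j))) k ⟩
  sum (λ j → pmul (row j) (det n (minor j)) k)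
    ≡⟨ sum-cong-≗ (λ j → pmul-congʳ (row j) (det-leibniz n (minor j)) k) ⟩
  sum (λ j → pmul (row j) (λ k → ∑Code (λ c → term j c k)) k)
    ≡⟨ sum-cong-≗ (λ j → pmul-distribˡ-∑Code (row j) (term j) k) ⟩
  sum (λ j → ∑Code (λ c → pmul (row j) (term j c) k))
    ≡⟨ sum-cong-≗ (λ j → ∑Code-cong (λ c →
         pmul-pscale (-1^ (toℕ j)) (codeSign c) (M zero j) (pprodFin (λ i → minor j i (perm c i))) k)) ⟩
  ∑Code (λ c → codeSign c * pprodFin (λ i → M i (perm c i)) k) ∎
  where
  open ≡-Reasoning
  row : Fin (suc n) → Poly
  row j = pscale (-1^ (toℕ j)) (M zero j)
  minor : Fin (suc n) → Fin n → Fin n → Poly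
  minor j i l = M (suc i) (punchIn j l)
  term : Fin (suc n) → Code n → Poly
  term j c = pscale (codeSign c) (pprodFin (λ i → minor j i (perm c i)))

factor : Bool → ℤ → Poly
factor true  c = pX
factor false c = pconst c

pmul-factor : ∀ b c a m → pmul (factor b c) (pscale a (monomial m)) ≈
  pscale ((if b then + 1 else c) * a) (monomial (if b then suc m else m))
pmul-factor true  c a m k = begin
  pmul pX (pscale a (monomial m)) k ≡⟨ pmul-pX (pscale a (monomial m)) k ⟩
  shift (pscale a (monomial m)) k   ≡⟨ shift-monomial a m k ⟩
  a * monomial (suc m) k            ≡⟨ cong (_* monomial (suc m) k) (sym (ℤₚ.*-identityˡ a)) ⟩
  + 1 * a * monomial (suc m) k      ∎
  where open ≡-Reasoning
pmul-factor false c a m k = trans (pmul-pconst c (pscale a (monomial m)) k) (sym (ℤₚ.*-assoc c a _))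

pprodFin-factors : ∀ {n} (b : Fin n → Bool) (c : Fin n → ℤ) (h : Fin n → Poly) → (∀ i → h i ≈ factor (b i) (c i)) →
  pprodFin h ≈ pscale (product (λ i → if b i then + 1 else c i)) (monomial (count b))
pprodFin-factors {zero}  b c h h≈ zero    = refl
pprodFin-factors {zero}  b c h h≈ (suc k) = refl
pprodFin-factors {suc n} b c h h≈ k =
  trans (pmul-congʳ (h zero) (pprodFin-factors (b ∘ suc) (c ∘ suc) (h ∘ suc) (h≈ ∘ suc)) k)
        (trans (pmul-congˡ rest (h≈ zero) k) (pmul-factor (b zero) (c zero) P m k))
  where
  P : ℤ
  P = product (λ i → if b (suc i) then + 1 else c (suc i))
  m : ℕ
  m = count (b ∘ suc)
  rest : Poly
  rest = pscale P (monomial m)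

charMatrix : ∀ {n} → SignedDigraph n → Fin n → Fin n → Poly
charMatrix S i j = padd (if does (i ≟ j) then pX else pconst (+ 0)) (pconst (- adj S i j))

isFixed : ∀ {n} → Code n → Fin n → Bool
isFixed c i = does (i ≟ perm c i)

fixCount : ∀ {n} → Code n → ℕ
fixCount c = count (isFixed c)

weight : ∀ {n} → SignedDigraph n → Code n → ℤ
weight S c = product (λ i → if isFixed c i then + 1 else - adj S i (perm c i))

adj-diagonal : ∀ {n} (S : SignedDigraph n) i → adj S i i ≡ + 0
adj-diagonal S i with arc S i i | loopless S i
... | .nothing | refl = refl

charMatrix-factor : ∀ {n} (S : SignedDigraph n) i j → charMatrix S i j ≈ factor (does (i ≟ j)) (- adj S i j)
charMatrix-factor S i j k with i ≟ j
... | yes refl rewrite adj-diagonal S i = trans (cong₂ _+_ (refl {x = pX k}) (pconst-zero k)) (ℤₚ.+-identityʳ (pX k))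
... | no _ = trans (cong₂ _+_ (pconst-zero k) refl) (ℤₚ.+-identityˡ _)

charPoly-leibniz : ∀ {n} (S : SignedDigraph n) k →
  charPoly S k ≡ ∑Code (λ c → codeSign c * (weight S c * monomial (fixCount c) k))
charPoly-leibniz {n} S k = trans (det-leibniz n (charMatrix S) k) (∑Code-cong λ c →
  cong (codeSign c *_) (pprodFin-factors (isFixed c) (λ i → - adj S i (perm c i)) (λ i → charMatrix S i (perm c i))
                                      (λ i → charMatrix-factor S i (perm c i)) k))

-- Negating every arc

adj-negSD : ∀ {n} (S : SignedDigraph n) i j → adj (negSD S) i j ≡ - adj S i j
adj-negSD S i j with arc S i j
... | nothing     = refl
... | just Sign.+ = refl
... | just Sign.- = refl

product-negate-unmarked : ∀ {n} (b : Fin n → Bool) (w : Fin n → ℤ) →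
  product (λ i → if b i then + 1 else - w i) * -1^ (count b) ≡ -1^ n * product (λ i → if b i then + 1 else w i)
product-negate-unmarked {zero}  b w = refl
product-negate-unmarked {suc n} b w = step (b zero) (product-negate-unmarked (b ∘ suc) (w ∘ suc))
  where
  open ≡-Reasoning
  P⁻ P : ℤ
  P⁻ = product (λ i → if b (suc i) then + 1 else - w (suc i))
  P  = product (λ i → if b (suc i) then + 1 else w (suc i))
  m : ℕ
  m = count (b ∘ suc)
  step : ∀ b₀ → P⁻ * -1^ m ≡ -1^ n * P →
    (if b₀ then + 1 else - w zero) * P⁻ * -1^ (if b₀ then suc m else m) ≡ -1^ (suc n) * ((if b₀ then + 1 else w zero) * P)
  step true ih = begin
    + 1 * P⁻ * (- (+ 1) * -1^ m)
      ≡⟨ solve 2 (λ x y → con (+ 1) :* x :* (:- con (+ 1) :* y) := :- con (+ 1) :* (x :* y)) refl P⁻ (-1^ m) ⟩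
    - (+ 1) * (P⁻ * -1^ m)
      ≡⟨ cong (- (+ 1) *_) ih ⟩
    - (+ 1) * (-1^ n * P)
      ≡⟨ solve 2 (λ x y → :- con (+ 1) :* (x :* y) := :- con (+ 1) :* x :* (con (+ 1) :* y)) refl (-1^ n) P ⟩
    - (+ 1) * -1^ n * (+ 1 * P) ∎
  step false ih = begin
    - w zero * P⁻ * -1^ m
      ≡⟨ ℤₚ.*-assoc (- w zero) P⁻ (-1^ m) ⟩
    - w zero * (P⁻ * -1^ m)
      ≡⟨ cong (- w zero *_) ih ⟩
    - w zero * (-1^ n * P)
      ≡⟨ solve 3 (λ a x y → :- a :* (x :* y) := :- con (+ 1) :* x :* (a :* y)) refl (w zero) (-1^ n) P ⟩
    - (+ 1) * -1^ n * (w zero * P) ∎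

weight-negSD : ∀ {n} (S : SignedDigraph n) c → weight (negSD S) c * -1^ (fixCount c) ≡ -1^ n * weight S c
weight-negSD S c = trans
  (cong (_* -1^ (fixCount c)) (product-cong λ i → cong (if isFixed c i then + 1 else_) (cong -_ (adj-negSD S i (perm c i)))))
  (product-negate-unmarked (isFixed c) (λ i → - adj S i (perm c i)))

monomial-term-negate : ∀ n a w⁻ w m k → w⁻ * -1^ m ≡ -1^ n * w →
  a * (w⁻ * monomial m k) ≡ -1^ n * (-1^ k * (a * (w * monomial m k)))
monomial-term-negate n a w⁻ w m k eq with m ℕ.≟ k
... | yes refl rewrite monomial-diagonal m = begin
  a * (w⁻ * + 1)
    ≡⟨ cong (λ t → a * (w⁻ * t)) (sym (-1^-square m)) ⟩
  a * (w⁻ * (-1^ m * -1^ m))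
    ≡⟨ solve 3 (λ a w x → a :* (w :* (x :* x)) := (a :* x) :* (w :* x)) refl a w⁻ (-1^ m) ⟩
  a * -1^ m * (w⁻ * -1^ m)
    ≡⟨ cong (a * -1^ m *_) eq ⟩
  a * -1^ m * (-1^ n * w)
    ≡⟨ solve 4 (λ a x y w → (a :* x) :* (y :* w) := y :* (x :* (a :* (w :* con (+ 1))))) refl a (-1^ m) (-1^ n) w ⟩
  -1^ n * (-1^ m * (a * (w * + 1))) ∎
  where open ≡-Reasoning
... | no m≢k rewrite monomial-off-diagonal m≢k =
  solve 5 (λ a w⁻ x y w → a :* (w⁻ :* con (+ 0)) := x :* (y :* (a :* (w :* con (+ 0))))) refl a w⁻ (-1^ n) (-1^ k) w

charPoly-negSD : ∀ {n} (S : SignedDigraph n) k → charPoly (negSD S) k ≡ -1^ n * (-1^ k * charPoly S k)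
charPoly-negSD {n} S k = begin
  charPoly (negSD S) k
    ≡⟨ charPoly-leibniz (negSD S) k ⟩
  ∑Code (λ c → codeSign c * (weight (negSD S) c * monomial (fixCount c) k))
    ≡⟨ ∑Code-cong (λ c → monomial-term-negate n (codeSign c) (weight (negSD S) c) (weight S c) (fixCount c) k (weight-negSD S c)) ⟩
  ∑Code (λ c → -1^ n * (-1^ k * term c))
    ≡⟨ ∑Code-scale (-1^ n) (λ c → -1^ k * term c) ⟩
  -1^ n * ∑Code (λ c → -1^ k * term c)
    ≡⟨ cong (-1^ n *_) (∑Code-scale (-1^ k) term) ⟩
  -1^ n * (-1^ k * ∑Code term)
    ≡⟨ cong (λ t → -1^ n * (-1^ k * t)) (sym (charPoly-leibniz S k)) ⟩
  -1^ n * (-1^ k * charPoly S k) ∎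
  where
  open ≡-Reasoning
  term : Code n → ℤ
  term c = codeSign c * (weight S c * monomial (fixCount c) k)

charPoly-negSD-split : ∀ {n} (S : SignedDigraph n) j k → j ℕ.+ k ≡ n → charPoly (negSD S) k ≡ -1^ j * charPoly S k
charPoly-negSD-split S j k refl = begin
  charPoly (negSD S) k
    ≡⟨ charPoly-negSD S k ⟩
  -1^ (j ℕ.+ k) * (-1^ k * charPoly S k)
    ≡⟨ cong (_* (-1^ k * charPoly S k)) (-1^-+ j k) ⟩
  -1^ j * -1^ k * (-1^ k * charPoly S k)
    ≡⟨ solve 3 (λ a b x → a :* b :* (b :* x) := a :* ((b :* b) :* x)) refl (-1^ j) (-1^ k) (charPoly S k) ⟩
  -1^ j * (-1^ k * -1^ k * charPoly S k)
    ≡⟨ cong (λ t → -1^ j * (t * charPoly S k)) (-1^-square k) ⟩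
  -1^ j * (+ 1 * charPoly S k)
    ≡⟨ cong (-1^ j *_) (ℤₚ.*-identityˡ _) ⟩
  -1^ j * charPoly S k ∎
  where open ≡-Reasoning

-- Cycles of a permutation

infix 10 _^[_]_
_^[_]_ : ∀ {n} → (Fin n → Fin n) → ℕ → Fin n → Fin n
σ ^[ zero  ] x = x
σ ^[ suc k ] x = σ (σ ^[ k ] x)

^-+ : ∀ {n} (σ : Fin n → Fin n) a b x → σ ^[ a ℕ.+ b ] x ≡ σ ^[ a ] (σ ^[ b ] x)
^-+ σ zero    b x = refl
^-+ σ (suc a) b x = cong σ (^-+ σ a b x)

^-injective : ∀ {n} {σ : Fin n → Fin n} → Injective _≡_ _≡_ σ → ∀ k {x y} → σ ^[ k ] x ≡ σ ^[ k ] y → x ≡ y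
^-injective σ-inj zero    eq = eq
^-injective σ-inj (suc k) eq = ^-injective σ-inj k (σ-inj eq)

^-cong : ∀ {n} {σ τ : Fin n → Fin n} → (∀ x → σ x ≡ τ x) → ∀ k x → σ ^[ k ] x ≡ τ ^[ k ] x
^-cong     σ≗τ zero    x = refl
^-cong {σ = σ} σ≗τ (suc k) x = trans (cong σ (^-cong σ≗τ k x)) (σ≗τ _)

^-fixed : ∀ {n} (σ : Fin n → Fin n) {x} → σ x ≡ x → ∀ k → σ ^[ k ] x ≡ x
^-fixed σ σx≡x zero    = refl
^-fixed σ σx≡x (suc k) = trans (cong σ (^-fixed σ σx≡x k)) σx≡x

orbit-period : ∀ {n} {σ : Fin n → Fin n} → Injective _≡_ _≡_ σ → ∀ x →
  Σ ℕ λ p → 0 < p × p ≤ n × σ ^[ p ] x ≡ x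
orbit-period {n} {σ} σ-inj x with Finₚ.pigeonhole (ℕₚ.n<1+n n) (λ t → σ ^[ toℕ t ] x)
... | i , j , i<j , σⁱx≡σʲx =
  toℕ j ∸ toℕ i , ℕₚ.m<n⇒0<n∸m i<j ,
  ℕₚ.≤-trans (ℕₚ.m∸n≤m (toℕ j) (toℕ i)) (ℕₚ.<⇒≤pred (Finₚ.toℕ<n j)) ,
  ^-injective σ-inj (toℕ i) (sym (begin
    σ ^[ toℕ i ] x                          ≡⟨ σⁱx≡σʲx ⟩
    σ ^[ toℕ j ] x                          ≡⟨ cong (λ t → σ ^[ t ] x) (sym (ℕₚ.m+[n∸m]≡n (ℕₚ.<⇒≤ i<j))) ⟩
    σ ^[ toℕ i ℕ.+ (toℕ j ∸ toℕ i) ] x      ≡⟨ ^-+ σ (toℕ i) (toℕ j ∸ toℕ i) x ⟩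
    σ ^[ toℕ i ] (σ ^[ toℕ j ∸ toℕ i ] x)   ∎))
  where open ≡-Reasoning

^-reduce-period : ∀ {n} (σ : Fin n → Fin n) {x p} → 0 < p → σ ^[ p ] x ≡ x →
  ∀ k → Σ ℕ λ k′ → k′ < p × σ ^[ k ] x ≡ σ ^[ k′ ] x
^-reduce-period σ     0<p σᵖx≡x zero = 0 , 0<p , refl
^-reduce-period σ {x} {p} 0<p σᵖx≡x (suc k) with ^-reduce-period σ 0<p σᵖx≡x k
... | k′ , k′<p , eq with suc k′ ℕ.<? p
...   | yes k′+1<p = suc k′ , k′+1<p , cong σ eq
...   | no  k′+1≮p =
  0 , 0<p , trans (cong σ eq) (trans (cong (λ t → σ ^[ t ] x) (ℕₚ.≤-antisym k′<p (ℕₚ.≮⇒≥ k′+1≮p))) σᵖx≡x)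

^-reduce : ∀ {n} {σ : Fin n → Fin n} → Injective _≡_ _≡_ σ →
  ∀ x k → Σ ℕ λ k′ → k′ < n × σ ^[ k ] x ≡ σ ^[ k′ ] x
^-reduce {σ = σ} σ-inj x k with orbit-period σ-inj x
... | p , 0<p , p≤n , σᵖx≡x with ^-reduce-period σ 0<p σᵖx≡x k
...   | k′ , k′<p , eq = k′ , ℕₚ.<-≤-trans k′<p p≤n , eq

IsOrbitMin : ∀ {n} → (Fin n → Fin n) → Fin n → Set
IsOrbitMin σ v = ∀ k → toℕ v ≤ toℕ (σ ^[ k ] v)

isOrbitMin : ∀ {n} → (Fin n → Fin n) → Fin n → Bool
isOrbitMin {n} σ v = allᵇ (λ k → toℕ v ≤ᵇ toℕ (σ ^[ k ] v)) (List.upTo n)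

isOrbitMin⇒IsOrbitMin : ∀ {n} {σ : Fin n → Fin n} → Injective _≡_ _≡_ σ → ∀ v → T (isOrbitMin σ v) → IsOrbitMin σ v
isOrbitMin⇒IsOrbitMin {n} {σ} σ-inj v t k with ^-reduce σ-inj v k
... | k′ , k′<n , eq rewrite eq =
  ℕₚ.≤ᵇ⇒≤ _ _ (Allₚ.applyUpTo⁻ id n (allᵇ⇒All _ (List.upTo n) t) k′<n)

IsOrbitMin⇒isOrbitMin : ∀ {n} {σ : Fin n → Fin n} v → IsOrbitMin σ v → T (isOrbitMin σ v)
IsOrbitMin⇒isOrbitMin {n} v min = All⇒allᵇ _ (Allₚ.applyUpTo⁺₁ id n (λ {k} _ → ℕₚ.≤⇒≤ᵇ (min k)))

cycleCount : ∀ {n} → (Fin n → Fin n) → ℕ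
cycleCount σ = count (isOrbitMin σ)

cycleCount-cong : ∀ {n} {σ τ : Fin n → Fin n} → (∀ x → σ x ≡ τ x) → cycleCount σ ≡ cycleCount τ
cycleCount-cong {n} σ≗τ =
  count-cong λ v → allᵇ-cong (λ k → cong (λ w → toℕ v ≤ᵇ toℕ w) (^-cong σ≗τ k v)) (List.upTo n)

transpose-matchˡ : ∀ {n} (i j : Fin n) → transpose i j i ≡ j
transpose-matchˡ i j rewrite dec-true (i ≟ i) refl = refl

transpose-matchʳ : ∀ {n} (i j : Fin n) → transpose i j j ≡ i
transpose-matchʳ i j with j ≟ i
... | yes refl = refl
... | no  _   rewrite dec-true (j ≟ j) refl = refl

transpose-other : ∀ {n} {i j k : Fin n} → k ≢ i → k ≢ j → transpose i j k ≡ k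
transpose-other {i = i} {j} {k} k≢i k≢j rewrite dec-false (k ≟ i) k≢i | dec-false (k ≟ j) k≢j = refl

transpose-self : ∀ {n} (i k : Fin n) → transpose i i k ≡ k
transpose-self i k = by-cases (k ≟ i)
  where
  by-cases : Dec (k ≡ i) → transpose i i k ≡ k
  by-cases (yes refl) = transpose-matchˡ k k
  by-cases (no  k≢i)  = transpose-other k≢i k≢i

transpose-comm : ∀ {n} (i j k : Fin n) → transpose i j k ≡ transpose j i k
transpose-comm i j k = by-cases (k ≟ i) (k ≟ j)
  where
  by-cases : Dec (k ≡ i) → Dec (k ≡ j) → transpose i j k ≡ transpose j i k
  by-cases (yes refl) (yes refl) = refl
  by-cases (yes refl) (no  k≢j)  = trans (transpose-matchˡ k j) (sym (transpose-matchʳ j k))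
  by-cases (no  k≢i)  (yes refl) = trans (transpose-matchʳ i k) (sym (transpose-matchˡ k i))
  by-cases (no  k≢i)  (no  k≢j)  = trans (transpose-other k≢i k≢j) (sym (transpose-other k≢j k≢i))

transpose-involutive : ∀ {n} (i j k : Fin n) → transpose i j (transpose i j k) ≡ k
transpose-involutive i j k = trans (cong (transpose i j) (transpose-comm i j k)) (transpose-inverse i j)

transpose-injective : ∀ {n} (i j : Fin n) → Injective _≡_ _≡_ (transpose i j)
transpose-injective i j {x} {y} eq =
  trans (sym (transpose-involutive i j x)) (trans (cong (transpose i j) eq) (transpose-involutive i j y))

transpose-map : ∀ {m n} {h : Fin m → Fin n} → Injective _≡_ _≡_ h → ∀ i j k →
  transpose (h i) (h j) (h k) ≡ h (transpose i j k)
transpose-map {h = h} h-inj i j k = by-cases (k ≟ i) (k ≟ j)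
  where
  by-cases : Dec (k ≡ i) → Dec (k ≡ j) → transpose (h i) (h j) (h k) ≡ h (transpose i j k)
  by-cases (yes refl) _          = trans (transpose-matchˡ (h k) (h j)) (cong h (sym (transpose-matchˡ k j)))
  by-cases (no  k≢i)  (yes refl) = trans (transpose-matchʳ (h i) (h k)) (cong h (sym (transpose-matchʳ i k)))
  by-cases (no  k≢i)  (no  k≢j)  =
    trans (transpose-other (k≢i ∘ h-inj) (k≢j ∘ h-inj)) (cong h (sym (transpose-other k≢i k≢j)))

-- Away from the last vertex L, transpose L (σ L) ∘ σ is σ with L short-cut out of its cycle; as a
-- composite with a transposition it turns the case analysis below into identities between transpositions.
skipLast : ∀ {m} → (Fin (suc m) → Fin (suc m)) → Fin (suc m) → Fin (suc m)
skipLast {m} σ x = transpose (fromℕ m) (σ (fromℕ m)) (σ x)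

skipLast-hit : ∀ {m} (σ : Fin (suc m) → Fin (suc m)) {x} → σ x ≡ fromℕ m → skipLast σ x ≡ σ (fromℕ m)
skipLast-hit {m} σ σx≡L =
  trans (cong (transpose (fromℕ m) (σ (fromℕ m))) σx≡L) (transpose-matchˡ (fromℕ m) (σ (fromℕ m)))

skipLast-miss : ∀ {m} {σ : Fin (suc m) → Fin (suc m)} → Injective _≡_ _≡_ σ →
  ∀ {x} → x ≢ fromℕ m → σ x ≢ fromℕ m → skipLast σ x ≡ σ x
skipLast-miss σ-inj x≢L σx≢L = transpose-other σx≢L (x≢L ∘ σ-inj)

skipLast≢last : ∀ {m} {σ : Fin (suc m) → Fin (suc m)} → Injective _≡_ _≡_ σ →
  ∀ {x} → x ≢ fromℕ m → skipLast σ x ≢ fromℕ m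
skipLast≢last {m} {σ} σ-inj {x} x≢L eq = x≢L (σ-inj (begin
  σ x                              ≡⟨ sym (transpose-involutive L (σ L) (σ x)) ⟩
  transpose L (σ L) (skipLast σ x) ≡⟨ cong (transpose L (σ L)) eq ⟩
  transpose L (σ L) L              ≡⟨ transpose-matchˡ L (σ L) ⟩
  σ L                              ∎))
  where
  open ≡-Reasoning
  L : Fin (suc m)
  L = fromℕ m

-- The default d is a junk value, returned only for the last vertex.
lowerLast : ∀ {m} → Fin m → Fin (suc m) → Fin m
lowerLast {m} d x with m ℕ.≟ toℕ x
... | yes _   = d
... | no  m≢x = Fin.lower₁ x m≢x

inject₁-lowerLast : ∀ {m} (d : Fin m) {x} → x ≢ fromℕ m → inject₁ (lowerLast d x) ≡ x
inject₁-lowerLast {m} d {x} x≢L with m ℕ.≟ toℕ x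
... | yes m≡x = contradiction (Finₚ.toℕ-injective (trans (sym m≡x) (sym (Finₚ.toℕ-fromℕ m)))) x≢L
... | no  m≢x = Finₚ.inject₁-lower₁ x m≢x

inject₁≢last : ∀ {m} (i : Fin m) → inject₁ i ≢ fromℕ m
inject₁≢last i eq = Finₚ.fromℕ≢inject₁ (sym eq)

splice : ∀ {m} → (Fin (suc m) → Fin (suc m)) → Fin m → Fin m
splice σ i = lowerLast i (skipLast σ (inject₁ i))

inject₁-splice : ∀ {m} {σ : Fin (suc m) → Fin (suc m)} → Injective _≡_ _≡_ σ →
  ∀ i → inject₁ (splice σ i) ≡ skipLast σ (inject₁ i)
inject₁-splice σ-inj i = inject₁-lowerLast i (skipLast≢last σ-inj (inject₁≢last i))

splice-injective : ∀ {m} {σ : Fin (suc m) → Fin (suc m)} → Injective _≡_ _≡_ σ → Injective _≡_ _≡_ (splice σ)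
splice-injective {m} {σ} σ-inj {i} {j} eq = Finₚ.inject₁-injective (σ-inj (transpose-injective (fromℕ m) (σ (fromℕ m))
  (trans (sym (inject₁-splice σ-inj i)) (trans (cong inject₁ eq) (inject₁-splice σ-inj j)))))

module _ {m} {σ : Fin (suc m) → Fin (suc m)} (σ-inj : Injective _≡_ _≡_ σ) (i : Fin m) where

  splice-orbit⊆orbit : ∀ k → Σ ℕ λ k′ → inject₁ (splice σ ^[ k ] i) ≡ σ ^[ k′ ] inject₁ i
  splice-orbit⊆orbit zero = 0 , refl
  splice-orbit⊆orbit (suc k) with splice-orbit⊆orbit k
  ... | k′ , eq with σ (σ ^[ k′ ] inject₁ i) ≟ fromℕ m
  ...   | yes hit  = suc (suc k′) , trans (inject₁-splice σ-inj _) (trans (cong (skipLast σ) eq)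
                                      (trans (skipLast-hit σ hit) (cong σ (sym hit))))
  ...   | no  miss = suc k′ , trans (inject₁-splice σ-inj _) (trans (cong (skipLast σ) eq)
                                  (skipLast-miss σ-inj (λ σᵏ′≡L → inject₁≢last _ (trans eq σᵏ′≡L)) miss))

  orbit⊆splice-orbit : ∀ k → Σ ℕ λ k′ → let y = inject₁ (splice σ ^[ k′ ] i) in
    σ ^[ k ] inject₁ i ≡ y ⊎ (σ ^[ k ] inject₁ i ≡ fromℕ m × σ y ≡ fromℕ m)
  orbit⊆splice-orbit zero = 0 , inj₁ refl
  orbit⊆splice-orbit (suc k) with orbit⊆splice-orbit k
  ... | k′ , inj₁ eq with σ (inject₁ (splice σ ^[ k′ ] i)) ≟ fromℕ m
  ...   | yes hit  = k′ , inj₂ (trans (cong σ eq) hit , hit)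
  ...   | no  miss = suc k′ , inj₁ (trans (cong σ eq)
                                   (sym (trans (inject₁-splice σ-inj _) (skipLast-miss σ-inj (inject₁≢last _) miss))))
  orbit⊆splice-orbit (suc k) | k′ , inj₂ (eq , hit) =
    suc k′ , inj₁ (trans (cong σ eq) (sym (trans (inject₁-splice σ-inj _) (skipLast-hit σ hit))))

  IsOrbitMin-splice⁺ : IsOrbitMin σ (inject₁ i) → IsOrbitMin (splice σ) i
  IsOrbitMin-splice⁺ min k with splice-orbit⊆orbit k
  ... | k′ , eq = subst₂ _≤_ (Finₚ.toℕ-inject₁ i) (trans (cong toℕ (sym eq)) (Finₚ.toℕ-inject₁ _)) (min k′)

  IsOrbitMin-splice⁻ : IsOrbitMin (splice σ) i → IsOrbitMin σ (inject₁ i)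
  IsOrbitMin-splice⁻ min k with orbit⊆splice-orbit k
  ... | k′ , inj₁ eq =
    subst₂ _≤_ (sym (Finₚ.toℕ-inject₁ i)) (trans (sym (Finₚ.toℕ-inject₁ _)) (cong toℕ (sym eq))) (min k′)
  ... | k′ , inj₂ (eq , _) rewrite eq =
    subst₂ _≤_ (sym (Finₚ.toℕ-inject₁ i)) (sym (Finₚ.toℕ-fromℕ m)) (ℕₚ.<⇒≤ (Finₚ.toℕ<n i))

  isOrbitMin-splice : isOrbitMin σ (inject₁ i) ≡ isOrbitMin (splice σ) i
  isOrbitMin-splice = T-ext
    (IsOrbitMin⇒isOrbitMin i ∘ IsOrbitMin-splice⁺ ∘ isOrbitMin⇒IsOrbitMin σ-inj (inject₁ i))
    (IsOrbitMin⇒isOrbitMin (inject₁ i) ∘ IsOrbitMin-splice⁻ ∘ isOrbitMin⇒IsOrbitMin (splice-injective σ-inj) i)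

fixesLast : ∀ {m} → (Fin (suc m) → Fin (suc m)) → Bool
fixesLast {m} σ = does (σ (fromℕ m) ≟ fromℕ m)

isOrbitMin-last : ∀ {m} {σ : Fin (suc m) → Fin (suc m)} → Injective _≡_ _≡_ σ → isOrbitMin σ (fromℕ m) ≡ fixesLast σ
isOrbitMin-last {m} {σ} σ-inj with σ (fromℕ m) ≟ fromℕ m
... | yes σL≡L = T⇒≡true (IsOrbitMin⇒isOrbitMin (fromℕ m) (λ k → ℕₚ.≤-reflexive (cong toℕ (sym (^-fixed σ σL≡L k)))))
... | no  σL≢L = ¬T⇒≡false λ t → σL≢L (Finₚ.toℕ-injective (ℕₚ.≤-antisym
  (ℕₚ.≤-trans (ℕₚ.<⇒≤pred (Finₚ.toℕ<n (σ (fromℕ m)))) (ℕₚ.≤-reflexive (sym (Finₚ.toℕ-fromℕ m))))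
  (isOrbitMin⇒IsOrbitMin σ-inj (fromℕ m) t 1)))

cycleCount-splice : ∀ {m} {σ : Fin (suc m) → Fin (suc m)} → Injective _≡_ _≡_ σ →
  cycleCount σ ≡ cycleCount (splice σ) ℕ.+ bit (fixesLast σ)
cycleCount-splice {σ = σ} σ-inj = trans (count-last (isOrbitMin σ))
  (cong₂ ℕ._+_ (count-cong (isOrbitMin-splice σ-inj)) (cong bit (isOrbitMin-last σ-inj)))

-1^-cycleCount-splice : ∀ {m} {σ : Fin (suc m) → Fin (suc m)} → Injective _≡_ _≡_ σ →
  -1^ (cycleCount σ) ≡ -1^ (cycleCount (splice σ)) * -1^ (bit (fixesLast σ))
-1^-cycleCount-splice {σ = σ} σ-inj =
  trans (cong -1^ (cycleCount-splice σ-inj)) (-1^-+ (cycleCount (splice σ)) (bit (fixesLast σ)))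

splice-compose : ∀ {m} {σ : Fin (suc m) → Fin (suc m)} (g F : Fin (suc m) → Fin (suc m)) (F′ : Fin m → Fin m) →
  Injective _≡_ _≡_ σ → Injective _≡_ _≡_ g → (∀ i → F (inject₁ i) ≡ inject₁ (F′ i)) →
  (∀ y → transpose (fromℕ m) (g (σ (fromℕ m))) (g y) ≡ F (transpose (fromℕ m) (σ (fromℕ m)) y)) →
  ∀ i → splice (g ∘ σ) i ≡ F′ (splice σ i)
splice-compose {m} {σ} g F F′ σ-inj g-inj F-inject₁ conj i = Finₚ.inject₁-injective (begin
  inject₁ (splice (g ∘ σ) i)                  ≡⟨ inject₁-splice (σ-inj ∘ g-inj) i ⟩
  transpose L (g (σ L)) (g (σ (inject₁ i)))   ≡⟨ conj (σ (inject₁ i)) ⟩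
  F (skipLast σ (inject₁ i))                  ≡⟨ cong F (sym (inject₁-splice σ-inj i)) ⟩
  F (inject₁ (splice σ i))                    ≡⟨ F-inject₁ (splice σ i) ⟩
  inject₁ (F′ (splice σ i))                   ∎)
  where
  open ≡-Reasoning
  L : Fin (suc m)
  L = fromℕ m

-- A transposition flips the parity of the number of cycles

last-or-inject₁ : ∀ {m} (x : Fin (suc m)) → x ≡ fromℕ m ⊎ Σ (Fin m) λ x′ → x ≡ inject₁ x′
last-or-inject₁ {zero}  zero    = inj₁ refl
last-or-inject₁ {suc m} zero    = inj₂ (zero , refl)
last-or-inject₁ {suc m} (suc x) with last-or-inject₁ x
... | inj₁ x≡L        = inj₁ (cong suc x≡L)
... | inj₂ (x′ , eq)  = inj₂ (suc x′ , cong suc eq)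

module _ {m} {σ τ : Fin (suc m) → Fin (suc m)} (σ-inj : Injective _≡_ _≡_ σ) (τ-inj : Injective _≡_ _≡_ τ) where

  flip-by-splice : -1^ (cycleCount (splice τ)) ≡ - -1^ (cycleCount (splice σ)) → fixesLast τ ≡ fixesLast σ →
    -1^ (cycleCount τ) ≡ - -1^ (cycleCount σ)
  flip-by-splice flip same = begin
    -1^ (cycleCount τ)
      ≡⟨ -1^-cycleCount-splice τ-inj ⟩
    -1^ (cycleCount (splice τ)) * -1^ (bit (fixesLast τ))
      ≡⟨ cong₂ (λ u v → u * -1^ (bit v)) flip same ⟩
    - -1^ (cycleCount (splice σ)) * -1^ (bit (fixesLast σ))
      ≡⟨ sym (ℤₚ.neg-distribˡ-* (-1^ (cycleCount (splice σ))) (-1^ (bit (fixesLast σ)))) ⟩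
    - (-1^ (cycleCount (splice σ)) * -1^ (bit (fixesLast σ)))
      ≡⟨ cong -_ (sym (-1^-cycleCount-splice σ-inj)) ⟩
    - -1^ (cycleCount σ) ∎
    where open ≡-Reasoning

  flip-by-last : (∀ i → splice τ i ≡ splice σ i) → fixesLast τ ≡ not (fixesLast σ) →
    -1^ (cycleCount τ) ≡ - -1^ (cycleCount σ)
  flip-by-last same flip = begin
    -1^ (cycleCount τ)
      ≡⟨ -1^-cycleCount-splice τ-inj ⟩
    -1^ (cycleCount (splice τ)) * -1^ (bit (fixesLast τ))
      ≡⟨ cong₂ (λ u v → -1^ u * -1^ (bit v)) (cycleCount-cong same) flip ⟩
    -1^ (cycleCount (splice σ)) * -1^ (bit (not (fixesLast σ)))
      ≡⟨ cong (-1^ (cycleCount (splice σ)) *_) (-1^-bit-not (fixesLast σ)) ⟩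
    -1^ (cycleCount (splice σ)) * - -1^ (bit (fixesLast σ))
      ≡⟨ sym (ℤₚ.neg-distribʳ-* (-1^ (cycleCount (splice σ))) (-1^ (bit (fixesLast σ)))) ⟩
    - (-1^ (cycleCount (splice σ)) * -1^ (bit (fixesLast σ)))
      ≡⟨ cong -_ (sym (-1^-cycleCount-splice σ-inj)) ⟩
    - -1^ (cycleCount σ) ∎
    where open ≡-Reasoning

TranspositionFlipsParity : ℕ → Set
TranspositionFlipsParity m = ∀ (σ : Fin (suc m) → Fin (suc m)) → Injective _≡_ _≡_ σ → ∀ {a b} → a ≢ b →
  -1^ (cycleCount (transpose a b ∘ σ)) ≡ - -1^ (cycleCount σ)

module _ {m} (ih : TranspositionFlipsParity m) (σ : Fin (suc (suc m)) → Fin (suc (suc m))) (σ-inj : Injective _≡_ _≡_ σ) where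
  private
    L : Fin (suc (suc m))
    L = fromℕ (suc m)

  transpose-inner-flips : ∀ {a b} → a ≢ b → -1^ (cycleCount (transpose (inject₁ a) (inject₁ b) ∘ σ)) ≡ - -1^ (cycleCount σ)
  transpose-inner-flips {a} {b} a≢b =
    flip-by-splice σ-inj (σ-inj ∘ g-inj) (trans (cong -1^ (cycleCount-cong spliced)) (ih (splice σ) (splice-injective σ-inj) a≢b))
      (does-≡ (g (σ L) ≟ L) (σ L ≟ L) (λ gσL≡L → g-inj (trans gσL≡L (sym gL≡L)))
                                      (λ σL≡L → trans (cong g σL≡L) gL≡L))
    where
    g : Fin (suc (suc m)) → Fin (suc (suc m))
    g = transpose (inject₁ a) (inject₁ b)
    g-inj : Injective _≡_ _≡_ g
    g-inj = transpose-injective (inject₁ a) (inject₁ b)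
    gL≡L : g L ≡ L
    gL≡L = transpose-other (inject₁≢last a ∘ sym) (inject₁≢last b ∘ sym)
    spliced : ∀ i → splice (g ∘ σ) i ≡ transpose a b (splice σ i)
    spliced = splice-compose g g (transpose a b) σ-inj g-inj (transpose-map Finₚ.inject₁-injective a b)
      (λ y → trans (cong (λ l → transpose l (g (σ L)) (g y)) (sym gL≡L)) (transpose-map g-inj L (σ L) y))

  module _ (b : Fin (suc m)) where
    private
      B : Fin (suc (suc m))
      B = inject₁ b
      B≢L : B ≢ L
      B≢L = inject₁≢last b
      g : Fin (suc (suc m)) → Fin (suc (suc m))
      g = transpose L B
      g-inj : Injective _≡_ _≡_ g
      g-inj = transpose-injective L B
      open ≡-Reasoning

    flips-if-last-fixed : σ L ≡ L → -1^ (cycleCount (g ∘ σ)) ≡ - -1^ (cycleCount σ)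
    flips-if-last-fixed σL≡L = flip-by-last σ-inj (σ-inj ∘ g-inj)
      (splice-compose g id id σ-inj g-inj (λ _ → refl) λ y → begin
        transpose L (g (σ L)) (g y) ≡⟨ cong (λ c → transpose L (g c) (g y)) σL≡L ⟩
        transpose L (g L) (g y)     ≡⟨ cong (λ c → transpose L c (g y)) (transpose-matchˡ L B) ⟩
        g (g y)                     ≡⟨ transpose-involutive L B y ⟩
        y                           ≡⟨ sym (transpose-self L y) ⟩
        transpose L L y             ≡⟨ cong (λ c → transpose L c y) (sym σL≡L) ⟩
        transpose L (σ L) y         ∎)
      (trans (dec-false (g (σ L) ≟ L) (λ gσL≡L → B≢L (trans (sym (trans (cong g σL≡L) (transpose-matchˡ L B))) gσL≡L)))
             (cong not (sym (dec-true (σ L ≟ L) σL≡L))))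

    flips-if-last-to-b : σ L ≡ B → -1^ (cycleCount (g ∘ σ)) ≡ - -1^ (cycleCount σ)
    flips-if-last-to-b σL≡B = flip-by-last σ-inj (σ-inj ∘ g-inj)
      (splice-compose g id id σ-inj g-inj (λ _ → refl) λ y → begin
        transpose L (g (σ L)) (g y) ≡⟨ cong (λ c → transpose L (g c) (g y)) σL≡B ⟩
        transpose L (g B) (g y)     ≡⟨ cong (λ c → transpose L c (g y)) (transpose-matchʳ L B) ⟩
        transpose L L (g y)         ≡⟨ transpose-self L (g y) ⟩
        transpose L B y             ≡⟨ cong (λ c → transpose L c y) (sym σL≡B) ⟩
        transpose L (σ L) y         ∎)
      (trans (dec-true (g (σ L) ≟ L) (trans (cong g σL≡B) (transpose-matchʳ L B)))
             (cong not (sym (dec-false (σ L ≟ L) (λ σL≡L → B≢L (trans (sym σL≡B) σL≡L))))))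

    flips-if-last-elsewhere : ∀ c → σ L ≡ inject₁ c → c ≢ b → -1^ (cycleCount (g ∘ σ)) ≡ - -1^ (cycleCount σ)
    flips-if-last-elsewhere c σL≡C c≢b = flip-by-splice σ-inj (σ-inj ∘ g-inj)
      (trans (cong -1^ (cycleCount-cong spliced)) (ih (splice σ) (splice-injective σ-inj) c≢b))
      (trans (dec-false (g (σ L) ≟ L) (λ gσL≡L → C≢L (trans (sym gC≡C) (trans (cong g (sym σL≡C)) gσL≡L))))
             (sym (dec-false (σ L ≟ L) (λ σL≡L → C≢L (trans (sym σL≡C) σL≡L)))))
      where
      C : Fin (suc (suc m))
      C = inject₁ c
      C≢L : C ≢ L
      C≢L = inject₁≢last c
      gC≡C : g C ≡ C
      gC≡C = transpose-other C≢L (c≢b ∘ Finₚ.inject₁-injective)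
      h : Fin (suc (suc m)) → Fin (suc (suc m))
      h = transpose L C
      spliced : ∀ i → splice (g ∘ σ) i ≡ transpose c b (splice σ i)
      spliced = splice-compose g (transpose C B) (transpose c b) σ-inj g-inj (transpose-map Finₚ.inject₁-injective c b)
        λ y → begin
          transpose L (g (σ L)) (g y)         ≡⟨ cong (λ c → transpose L (g c) (g y)) σL≡C ⟩
          transpose L (g C) (g y)             ≡⟨ cong (λ c → transpose L c (g y)) gC≡C ⟩
          h (g y)                             ≡⟨ sym (transpose-map (transpose-injective L C) L B y) ⟩
          transpose (h L) (h B) (h y)         ≡⟨ cong₂ (λ u v → transpose u v (h y)) (transpose-matchˡ L C)
                                                   (transpose-other B≢L (c≢b ∘ sym ∘ Finₚ.inject₁-injective)) ⟩
          transpose C B (h y)                 ≡⟨ cong (λ c → transpose C B (transpose L c y)) (sym σL≡C) ⟩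
          transpose C B (transpose L (σ L) y) ∎

    transpose-last-flips : -1^ (cycleCount (transpose L (inject₁ b) ∘ σ)) ≡ - -1^ (cycleCount σ)
    transpose-last-flips with last-or-inject₁ (σ L)
    ... | inj₁ σL≡L       = flips-if-last-fixed σL≡L
    ... | inj₂ (c , σL≡C) with c ≟ b
    ...   | yes refl = flips-if-last-to-b σL≡C
    ...   | no  c≢b  = flips-if-last-elsewhere c σL≡C c≢b

transposition-flips-parity : ∀ m → TranspositionFlipsParity m
transposition-flips-parity zero    σ σ-inj {zero} {zero} a≢b = contradiction refl a≢b
transposition-flips-parity (suc m) σ σ-inj {a} {b} a≢b with last-or-inject₁ a | last-or-inject₁ b
... | inj₁ refl        | inj₁ refl        = contradiction refl a≢b
... | inj₁ refl        | inj₂ (b′ , refl) = transpose-last-flips (transposition-flips-parity m) σ σ-inj b′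
... | inj₂ (a′ , refl) | inj₁ refl        =
  trans (cong -1^ (cycleCount-cong λ x → transpose-comm (inject₁ a′) (fromℕ (suc m)) (σ x)))
        (transpose-last-flips (transposition-flips-parity m) σ σ-inj a′)
... | inj₂ (a′ , refl) | inj₂ (b′ , refl) =
  transpose-inner-flips (transposition-flips-parity m) σ σ-inj (a≢b ∘ cong inject₁)

-- The sign of a Laplace code

perm-injective : ∀ {n} (c : Code n) → Injective _≡_ _≡_ (perm c)
perm-injective (j , c) {zero}  {zero}  _  = refl
perm-injective (j , c) {zero}  {suc y} eq = contradiction (sym eq) (Finₚ.punchInᵢ≢i j (perm c y))
perm-injective (j , c) {suc x} {zero}  eq = contradiction eq (Finₚ.punchInᵢ≢i j (perm c x))
perm-injective (j , c) {suc x} {suc y} eq = cong suc (perm-injective c (Finₚ.punchIn-injective j _ _ eq))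

transpose-punchIn : ∀ {n} (j y : Fin n) → transpose (inject₁ j) (suc j) (punchIn (suc j) y) ≡ punchIn (inject₁ j) y
transpose-punchIn zero    zero    = transpose-matchˡ zero (suc zero)
transpose-punchIn zero    (suc y) = transpose-other {i = zero} {suc zero} (λ ()) (λ ())
transpose-punchIn (suc j) zero    = transpose-other {i = suc (inject₁ j)} {suc (suc j)} (λ ()) (λ ())
transpose-punchIn (suc j) (suc y) =
  trans (transpose-map Finₚ.suc-injective (inject₁ j) (suc j) (punchIn (suc j) y)) (cong suc (transpose-punchIn j y))

transpose-perm : ∀ {n} (j : Fin n) (c : Code n) x →
  transpose (inject₁ j) (suc j) (perm (suc j , c) x) ≡ perm (inject₁ j , c) x
transpose-perm j c zero    = transpose-matchʳ (inject₁ j) (suc j)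
transpose-perm j c (suc i) = transpose-punchIn j (perm c i)

-1^-cycleCount-perm : ∀ {n} (j : Fin (suc n)) (c : Code n) →
  -1^ (cycleCount (perm (j , c))) ≡ -1^ (toℕ j) * -1^ (cycleCount (perm (zero , c)))
-1^-cycleCount-perm {n} j c = by-induction (toℕ j) j refl
  where
  open ≡-Reasoning
  σ₀ : Fin (suc n) → Fin (suc n)
  σ₀ = perm (zero , c)
  -- Induction on toℕ j: the step goes from suc j to inject₁ j, which is not a structural subterm.
  by-induction : ∀ k (j : Fin (suc n)) → toℕ j ≡ k → -1^ (cycleCount (perm (j , c))) ≡ -1^ (toℕ j) * -1^ (cycleCount σ₀)
  by-induction _       zero    _  = sym (ℤₚ.*-identityˡ _)
  by-induction (suc k) (suc j) eq = begin
    -1^ (cycleCount σ)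
      ≡⟨ sym (ℤₚ.neg-involutive _) ⟩
    - - -1^ (cycleCount σ)
      ≡⟨ cong -_ (sym (transposition-flips-parity n σ (perm-injective (suc j , c)) inject₁j≢sucj)) ⟩
    - -1^ (cycleCount (transpose (inject₁ j) (suc j) ∘ σ))
      ≡⟨ cong (λ t → - -1^ t) (cycleCount-cong (transpose-perm j c)) ⟩
    - -1^ (cycleCount (perm (inject₁ j , c)))
      ≡⟨ cong -_ (by-induction k (inject₁ j) (trans (Finₚ.toℕ-inject₁ j) (ℕₚ.suc-injective eq))) ⟩
    - (-1^ (toℕ (inject₁ j)) * -1^ (cycleCount σ₀))
      ≡⟨ cong (λ t → - (-1^ t * -1^ (cycleCount σ₀))) (Finₚ.toℕ-inject₁ j) ⟩
    - (-1^ (toℕ j) * -1^ (cycleCount σ₀))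
      ≡⟨ ℤₚ.neg-distribˡ-* (-1^ (toℕ j)) _ ⟩
    - -1^ (toℕ j) * -1^ (cycleCount σ₀)
      ≡⟨ cong (_* -1^ (cycleCount σ₀)) (sym (ℤₚ.-1*i≡-i (-1^ (toℕ j)))) ⟩
    -1^ (toℕ (suc j)) * -1^ (cycleCount σ₀) ∎
    where
    σ : Fin (suc n) → Fin (suc n)
    σ = perm (suc j , c)
    inject₁j≢sucj : inject₁ j ≢ suc j
    inject₁j≢sucj eq = ℕₚ.<-irrefl (trans (sym (Finₚ.toℕ-inject₁ j)) (cong toℕ eq)) (ℕₚ.n<1+n (toℕ j))

^-perm-zero : ∀ {n} (c : Code n) k i → perm (zero , c) ^[ k ] suc i ≡ suc (perm c ^[ k ] i)
^-perm-zero c zero    i = refl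
^-perm-zero c (suc k) i = cong (perm (zero , c)) (^-perm-zero c k i)

cycleCount-perm-zero : ∀ {n} (c : Code n) → cycleCount (perm (zero , c)) ≡ suc (cycleCount (perm c))
cycleCount-perm-zero {n} c
  rewrite T⇒≡true (IsOrbitMin⇒isOrbitMin {σ = perm (zero , c)} zero (λ _ → z≤n)) = cong suc (count-cong shifted)
  where
  shifted : ∀ i → isOrbitMin (perm (zero , c)) (suc i) ≡ isOrbitMin (perm c) i
  shifted i = T-ext
    (λ t → IsOrbitMin⇒isOrbitMin i λ k → ℕ.s≤s⁻¹ (subst (λ w → suc (toℕ i) ≤ toℕ w) (^-perm-zero c k i)
              (isOrbitMin⇒IsOrbitMin (perm-injective (zero , c)) (suc i) t k)))
    (λ t → IsOrbitMin⇒isOrbitMin (suc i) λ k → subst (λ w → suc (toℕ i) ≤ toℕ w) (sym (^-perm-zero c k i))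
              (s≤s (isOrbitMin⇒IsOrbitMin (perm-injective c) i t k)))

codeSign-cycleCount : ∀ {n} (c : Code n) → codeSign c ≡ -1^ n * -1^ (cycleCount (perm c))
codeSign-cycleCount {zero}  c       = refl
codeSign-cycleCount {suc n} (j , c) = begin
  -1^ (toℕ j) * codeSign c
    ≡⟨ cong (-1^ (toℕ j) *_) (codeSign-cycleCount c) ⟩
  -1^ (toℕ j) * (-1^ n * -1^ (cycleCount (perm c)))
    ≡⟨ solve 3 (λ a b y → a :* (b :* y) := (:- con (+ 1) :* b) :* (a :* (:- con (+ 1) :* y))) refl
               (-1^ (toℕ j)) (-1^ n) (-1^ (cycleCount (perm c))) ⟩
  -1^ (suc n) * (-1^ (toℕ j) * -1^ (suc (cycleCount (perm c))))
    ≡⟨ cong (λ t → -1^ (suc n) * (-1^ (toℕ j) * -1^ t)) (sym (cycleCount-perm-zero c)) ⟩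
  -1^ (suc n) * (-1^ (toℕ j) * -1^ (cycleCount (perm (zero , c))))
    ≡⟨ cong (-1^ (suc n) *_) (sym (-1^-cycleCount-perm j c)) ⟩
  -1^ (suc n) * -1^ (cycleCount (perm (j , c))) ∎
  where open ≡-Reasoning

-- The linear subdigraph of a permutation

nontrivialCycles : ∀ {n} → Code n → PMap n
nontrivialCycles c v = if isFixed c v then nothing else just (perm c v)

isFixed⇒fixed : ∀ {n} (c : Code n) v → isFixed c v ≡ true → perm c v ≡ v
isFixed⇒fixed c v t with v ≟ perm c v
... | yes v≡σv = sym v≡σv

isFixed⇒moved : ∀ {n} (c : Code n) v → isFixed c v ≡ false → perm c v ≢ v
isFixed⇒moved c v f with v ≟ perm c v
... | no v≢σv = v≢σv ∘ sym

moved-image : ∀ {n} (c : Code n) v → isFixed c v ≡ false → isFixed c (perm c v) ≡ false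
moved-image c v moved = dec-false (perm c v ≟ perm c (perm c v)) (isFixed⇒moved c v moved ∘ perm-injective c ∘ sym)

moved-orbit : ∀ {n} (c : Code n) v → isFixed c v ≡ false → ∀ k → isFixed c (perm c ^[ k ] v) ≡ false
moved-orbit c v moved zero    = moved
moved-orbit c v moved (suc k) = moved-image c (perm c ^[ k ] v) (moved-orbit c v moved k)

iter-cong : ∀ {n} {f g : PMap n} → f ≗ g → ∀ k x → iter f k x ≡ iter g k x
iter-cong     f≗g zero    x = refl
iter-cong {f = f} {g} f≗g (suc k) x with iter g k x | iter-cong f≗g k x
... | nothing | eq = cong (_>>= f) eq
... | just w  | eq = trans (cong (_>>= f) eq) (f≗g w)

-- isCycleMin, isLinear and linSign inspect f v inside where-bound functions, which cannot be named
-- outside their definitions; pointwise facts about them are therefore proved by refuting a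
-- counterexample (allᵇ-≢, foldr-map-≢) whose type Agda infers.
isCycleMin-orbit : ∀ {n} (f : PMap n) (σ : Fin n → Fin n) v → (∀ k → iter f k (just v) ≡ just (σ ^[ k ] v)) →
  isCycleMin f v ≡ is-just (f v) ∧ isOrbitMin σ v
isCycleMin-orbit {n} f σ v orbit with isCycleMin f v Boolₚ.≟ (is-just (f v) ∧ isOrbitMin σ v)
... | yes eq = eq
... | no  ne with allᵇ-≢ _ _ (List.upTo n) (∧-≢ (is-just (f v)) ne)
...   | k , neₖ with iter f k (just v) | orbit k | neₖ
...     | .(just (σ ^[ k ] v)) | refl | ne′ = contradiction refl ne′

fixed⇒isOrbitMin : ∀ {n} (c : Code n) i → isFixed c i ≡ true → isOrbitMin (perm c) i ≡ true
fixed⇒isOrbitMin c i fixed =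
  T⇒≡true (IsOrbitMin⇒isOrbitMin i λ k → ℕₚ.≤-reflexive (cong toℕ (sym (^-fixed (perm c) (isFixed⇒fixed c i fixed) k))))

adj-arc : ∀ {n} (S : SignedDigraph n) v w → T (is-just (arc S v w)) → adj S v w ≡ signℤ (arcSign S v w)
adj-arc S v w t with arc S v w
... | just _ = refl

adj-no-arc : ∀ {n} (S : SignedDigraph n) v w → is-just (arc S v w) ≡ false → adj S v w ≡ + 0
adj-no-arc S v w eq with arc S v w
... | nothing = refl

arcsPresent : ∀ {n} → SignedDigraph n → Code n → Bool
arcsPresent S c = allV (λ v → isFixed c v ∨ is-just (arc S v (perm c v)))

module _ {n} {f : PMap n} (c : Code n) (f≗c : f ≗ nontrivialCycles c) where

  is-just-cycles : ∀ v → is-just (f v) ≡ not (isFixed c v)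
  is-just-cycles v rewrite f≗c v with isFixed c v
  ... | true  = refl
  ... | false = refl

  iter-cycles : ∀ {v} → isFixed c v ≡ false → ∀ k → iter f k (just v) ≡ just (perm c ^[ k ] v)
  iter-cycles moved zero    = refl
  iter-cycles {v} moved (suc k) = begin
    (iter f k (just v) >>= f)                            ≡⟨ cong (_>>= f) (iter-cycles moved k) ⟩
    f (perm c ^[ k ] v)                                  ≡⟨ f≗c (perm c ^[ k ] v) ⟩
    nontrivialCycles c (perm c ^[ k ] v)                 ≡⟨ cong (λ b → if b then nothing else just (perm c ^[ suc k ] v))
                                                                 (moved-orbit c v moved k) ⟩
    just (perm c ^[ suc k ] v)                           ∎
    where open ≡-Reasoning

  order-cycles : order f ℕ.+ fixCount c ≡ n
  order-cycles = trans (cong (ℕ._+ fixCount c) (trans (countV≡count (λ v → is-just (f v))) (count-cong is-just-cycles)))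
                       (count-not (isFixed c))

  isCycleMin-cycles : ∀ v → isCycleMin f v ≡ not (isFixed c v) ∧ isOrbitMin (perm c) v
  isCycleMin-cycles v with isFixed c v in eq
  ... | true  = ∧-false (trans (is-just-cycles v) (cong not eq))
  ... | false = trans (isCycleMin-orbit f (perm c) v (iter-cycles eq))
                      (cong (_∧ isOrbitMin (perm c) v) (trans (is-just-cycles v) (cong not eq)))

  components-cycles : components f ℕ.+ fixCount c ≡ cycleCount (perm c)
  components-cycles = trans (cong (ℕ._+ fixCount c) (trans (countV≡count (isCycleMin f)) (count-cong isCycleMin-cycles)))
                            (count-split (isFixed c) (isOrbitMin (perm c)) (fixed⇒isOrbitMin c))

  module _ (S : SignedDigraph n) where

    unique-preimage : ∀ v u → not (eqMaybeFin (f u) (perm c v)) ∨ does (u ≟ v) ≡ true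
    unique-preimage v u rewrite f≗c u with isFixed c u
    ... | true  = refl
    ... | false with perm c u ≟ perm c v
    ...   | yes σu≡σv = dec-true (u ≟ v) (perm-injective c σu≡σv)
    ...   | no  _     = refl

    check-moved : ∀ v → isFixed c v ≡ false →
      is-just (f (perm c v)) ∧ (is-just (arc S v (perm c v)) ∧ allV (λ u → not (eqMaybeFin (f u) (perm c v)) ∨ does (u ≟ v)))
        ≡ is-just (arc S v (perm c v))
    check-moved v moved = begin
      is-just (f (perm c v)) ∧ (arcᵥ ∧ allV onlyPreimage)
        ≡⟨ cong₂ (λ a b → a ∧ (arcᵥ ∧ b)) target-moved preimage-unique ⟩
      arcᵥ ∧ true
        ≡⟨ Boolₚ.∧-identityʳ arcᵥ ⟩
      arcᵥ ∎
      where
      open ≡-Reasoning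
      arcᵥ : Bool
      arcᵥ = is-just (arc S v (perm c v))
      onlyPreimage : Fin n → Bool
      onlyPreimage u = not (eqMaybeFin (f u) (perm c v)) ∨ does (u ≟ v)
      target-moved : is-just (f (perm c v)) ≡ true
      target-moved = trans (is-just-cycles (perm c v)) (cong not (moved-image c v moved))
      preimage-unique : allV onlyPreimage ≡ true
      preimage-unique = T⇒≡true (All⇒allᵇ onlyPreimage (Allₚ.tabulate⁺ λ u → Equivalence.from T-≡ (unique-preimage v u)))

    isLinear-cycles : isLinear S f ≡ arcsPresent S c
    isLinear-cycles with isLinear S f Boolₚ.≟ arcsPresent S c
    ... | yes eq = eq
    ... | no  ne with allᵇ-≢ _ _ (List.allFin n) ne
    ...   | v , neᵥ with isFixed c v in fixed | f v | f≗c v | neᵥ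
    ...     | true  | .nothing            | refl | ne′ = contradiction refl ne′
    ...     | false | .(just (perm c v))  | refl | ne′ = contradiction (check-moved v fixed) ne′

    linSign-cycles : linSign S f ≡ List.foldr Sign._*_ Sign.+
      (List.map (λ v → if isFixed c v then Sign.+ else arcSign S v (perm c v)) (List.allFin n))
    linSign-cycles with linSign S f Signₚ.≟ List.foldr Sign._*_ Sign.+
                          (List.map (λ v → if isFixed c v then Sign.+ else arcSign S v (perm c v)) (List.allFin n))
    ... | yes eq = eq
    ... | no  ne with foldr-map-≢ _ _ (List.allFin n) ne
    ...   | v , neᵥ with isFixed c v | f v | f≗c v | neᵥ
    ...     | true  | .nothing           | refl | ne′ = contradiction refl ne′
    ...     | false | .(just (perm c v)) | refl | ne′ = contradiction refl ne′

    signℤ-linSign-cycles : signℤ (linSign S f) ≡ product (λ v → if isFixed c v then + 1 else signℤ (arcSign S v (perm c v)))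
    signℤ-linSign-cycles = trans (cong signℤ linSign-cycles)
      (trans (signℤ-foldr (λ v → if isFixed c v then Sign.+ else arcSign S v (perm c v)) id)
                                                             (product-cong λ v → signℤ-if (isFixed c v)))
      where
      signℤ-if : ∀ b {s} → signℤ (if b then Sign.+ else s) ≡ (if b then + 1 else signℤ s)
      signℤ-if true  = refl
      signℤ-if false = refl

sachsValue : ∀ {n} → SignedDigraph n → PMap n → ℤ
sachsValue S f = -1^ (components f) * signℤ (linSign S f)

weight-arcsPresent : ∀ {n} (S : SignedDigraph n) c → arcsPresent S c ≡ true →
  weight S c * -1^ (fixCount c) ≡ -1^ n * signℤ (linSign S (nontrivialCycles c))
weight-arcsPresent {n} S c arcs = begin
  weight S c * -1^ (fixCount c)
    ≡⟨ cong (_* -1^ (fixCount c)) (product-cong arc-factor) ⟩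
  product (λ i → if isFixed c i then + 1 else - signℤ (arcSign S i (perm c i))) * -1^ (fixCount c)
    ≡⟨ product-negate-unmarked (isFixed c) (λ i → signℤ (arcSign S i (perm c i))) ⟩
  -1^ n * product (λ i → if isFixed c i then + 1 else signℤ (arcSign S i (perm c i)))
    ≡⟨ cong (-1^ n *_) (sym (signℤ-linSign-cycles c (λ _ → refl) S)) ⟩
  -1^ n * signℤ (linSign S (nontrivialCycles c)) ∎
  where
  open ≡-Reasoning
  present : ∀ i → T (isFixed c i ∨ is-just (arc S i (perm c i)))
  present = Allₚ.tabulate⁻ (allᵇ⇒All _ (List.allFin n) (Equivalence.from T-≡ arcs))
  arc-factor : ∀ i → (if isFixed c i then + 1 else - adj S i (perm c i))
                     ≡ (if isFixed c i then + 1 else - signℤ (arcSign S i (perm c i)))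
  arc-factor i with isFixed c i | present i
  ... | true  | _ = refl
  ... | false | t = cong -_ (adj-arc S i (perm c i) t)

weight-arcMissing : ∀ {n} (S : SignedDigraph n) c → arcsPresent S c ≡ false → weight S c ≡ + 0
weight-arcMissing {n} S c missing with allᵇ≡false _ (List.allFin n) missing
... | i , absent = product-zero _ i (missing-factor (isFixed c i) absent)
  where
  missing-factor : ∀ b → b ∨ is-just (arc S i (perm c i)) ≡ false → (if b then + 1 else - adj S i (perm c i)) ≡ + 0
  missing-factor false no-arc = cong -_ (adj-no-arc S i (perm c i) no-arc)

codeSign*weight : ∀ {n} (S : SignedDigraph n) c →
  codeSign c * weight S c ≡ when (arcsPresent S c) (sachsValue S (nontrivialCycles c))
codeSign*weight {n} S c with arcsPresent S c in arcs
... | false = trans (cong (codeSign c *_) (weight-arcMissing S c arcs)) (ℤₚ.*-zeroʳ (codeSign c))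
... | true  = begin
  codeSign c * weight S c
    ≡⟨ cong (_* weight S c) (codeSign-cycleCount c) ⟩
  -1^ n * -1^ (cycleCount (perm c)) * weight S c
    ≡⟨ cong (λ t → -1^ n * -1^ t * weight S c) (sym (components-cycles c (λ _ → refl))) ⟩
  -1^ n * -1^ (p ℕ.+ fixCount c) * weight S c
    ≡⟨ cong (λ t → -1^ n * t * weight S c) (-1^-+ p (fixCount c)) ⟩
  -1^ n * (-1^ p * -1^ (fixCount c)) * weight S c
    ≡⟨ solve 4 (λ a b x w → a :* (b :* x) :* w := b :* (a :* (w :* x))) refl (-1^ n) (-1^ p) (-1^ (fixCount c)) (weight S c) ⟩
  -1^ p * (-1^ n * (weight S c * -1^ (fixCount c)))
    ≡⟨ cong (λ t → -1^ p * (-1^ n * t)) (weight-arcsPresent S c arcs) ⟩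
  -1^ p * (-1^ n * (-1^ n * s))
    ≡⟨ solve 3 (λ a b s → b :* (a :* (a :* s)) := b :* ((a :* a) :* s)) refl (-1^ n) (-1^ p) s ⟩
  -1^ p * (-1^ n * -1^ n * s)
    ≡⟨ cong (λ t → -1^ p * (t * s)) (-1^-square n) ⟩
  -1^ p * (+ 1 * s)
    ≡⟨ cong (-1^ p *_) (ℤₚ.*-identityˡ s) ⟩
  -1^ p * s ∎
  where
  open ≡-Reasoning
  p : ℕ
  p = components (nontrivialCycles c)
  s : ℤ
  s = signℤ (linSign S (nontrivialCycles c))

sachsTerm : ∀ {n} → SignedDigraph n → ℕ → PMap n → ℤ
sachsTerm {n} S k f = when (isLinear S f ∧ (order f ℕ.+ k ≡ᵇ n)) (sachsValue S f)

leibnizTerm≡sachsTerm : ∀ {n} (S : SignedDigraph n) k c →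
  codeSign c * (weight S c * monomial (fixCount c) k) ≡ sachsTerm S k (nontrivialCycles c)
leibnizTerm≡sachsTerm {n} S k c = begin
  codeSign c * (weight S c * monomial (fixCount c) k)
    ≡⟨ sym (ℤₚ.*-assoc (codeSign c) (weight S c) _) ⟩
  codeSign c * weight S c * monomial (fixCount c) k
    ≡⟨ cong (_* monomial (fixCount c) k) (codeSign*weight S c) ⟩
  when (arcsPresent S c) (sachsValue S L) * when (fixCount c ≡ᵇ k) (+ 1)
    ≡⟨ when-* (arcsPresent S c) (fixCount c ≡ᵇ k) (sachsValue S L) ⟩
  when (arcsPresent S c ∧ (fixCount c ≡ᵇ k)) (sachsValue S L)
    ≡⟨ cong₂ (λ a b → when (a ∧ b) (sachsValue S L)) (sym (isLinear-cycles c cycles S))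
             (≡ᵇ-shift {order L} {fixCount c} k (order-cycles c cycles)) ⟩
  sachsTerm S k L ∎
  where
  open ≡-Reasoning
  L : PMap n
  L = nontrivialCycles c
  cycles : L ≗ nontrivialCycles c
  cycles _ = refl

sachsTerm-cong : ∀ {n} (S : SignedDigraph n) k {f} c → f ≗ nontrivialCycles c → sachsTerm S k f ≡ sachsTerm S k (nontrivialCycles c)
sachsTerm-cong {n} S k {f} c f≗c = cong₂ when
  (cong₂ (λ a b → a ∧ (b ℕ.+ k ≡ᵇ n))
         (trans (isLinear-cycles c f≗c S) (sym (isLinear-cycles c cycles S)))
         (ℕₚ.+-cancelʳ-≡ (fixCount c) (order f) (order L)
           (trans (order-cycles c f≗c) (sym (order-cycles c cycles)))))
  (cong₂ (λ p s → -1^ p * s)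
         (ℕₚ.+-cancelʳ-≡ (fixCount c) (components f) (components L)
           (trans (components-cycles c f≗c) (sym (components-cycles c cycles))))
         (trans (signℤ-linSign-cycles c f≗c S) (sym (signℤ-linSign-cycles c cycles S))))
  where
  L : PMap n
  L = nontrivialCycles c
  cycles : L ≗ nontrivialCycles c
  cycles _ = refl

-- Every linear subdigraph comes from a unique permutation

code-ext : ∀ {n} (c c′ : Code n) → (∀ x → perm c x ≡ perm c′ x) → c ≡ c′
code-ext {zero}  _       _         _       = refl
code-ext {suc n} (j , c) (j′ , c′) perm≗ with perm≗ zero
... | refl = cong (j ,_) (code-ext c c′ λ x → Finₚ.punchIn-injective j _ _ (perm≗ (suc x)))

nontrivialCycles-injective : ∀ {n} (c c′ : Code n) → nontrivialCycles c ≗ nontrivialCycles c′ → c ≡ c′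
nontrivialCycles-injective c c′ cycles≗ = code-ext c c′ same-perm
  where
  same-perm : ∀ v → perm c v ≡ perm c′ v
  same-perm v with isFixed c v in fixed | isFixed c′ v in fixed′ | cycles≗ v
  ... | true  | true  | _    = trans (isFixed⇒fixed c v fixed) (sym (isFixed⇒fixed c′ v fixed′))
  ... | false | false | σv≡σ′v = Maybeₚ.just-injective σv≡σ′v

toCode : ∀ {n} (σ : Fin n → Fin n) → Injective _≡_ _≡_ σ → Code n
toCode {zero}  σ σ-inj = tt
toCode {suc n} σ σ-inj = σ zero , toCode (punchOut ∘ σ₀≢σsuc) λ {x} {y} eq →
  Finₚ.suc-injective (σ-inj (Finₚ.punchOut-injective (σ₀≢σsuc x) (σ₀≢σsuc y) eq))
  where
  σ₀≢σsuc : ∀ i → σ zero ≢ σ (suc i)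
  σ₀≢σsuc i eq with σ-inj eq
  ... | ()

perm-toCode : ∀ {n} (σ : Fin n → Fin n) (σ-inj : Injective _≡_ _≡_ σ) x → perm (toCode σ σ-inj) x ≡ σ x
perm-toCode {suc n} σ σ-inj zero    = refl
perm-toCode {suc n} σ σ-inj (suc i) = trans (cong (punchIn (σ zero)) (perm-toCode _ _ i)) (Finₚ.punchIn-punchOut _)

completion : ∀ {n} → PMap n → Fin n → Fin n
completion f v = fromMaybe v (f v)

completion-just : ∀ {n} (f : PMap n) {v w} → f v ≡ just w → completion f v ≡ w
completion-just f {v} fv≡w rewrite fv≡w = refl

completion-nothing : ∀ {n} (f : PMap n) {v} → f v ≡ nothing → completion f v ≡ v
completion-nothing f {v} fv≡nothing rewrite fv≡nothing = refl

module _ {n} (S : SignedDigraph n) {f : PMap n} (linear : T (isLinear S f)) where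

  only-preimage : ∀ {v w} u → f u ≡ just w → T (not (eqMaybeFin (f u) w) ∨ does (u ≟ v)) → u ≡ v
  only-preimage {v} {w} u fu≡w t rewrite fu≡w | dec-true (w ≟ w) refl with u ≟ v | t
  ... | yes u≡v | _ = u≡v

  linear-arc : ∀ {v w} → f v ≡ just w → T (is-just (f w)) × T (is-just (arc S v w)) × (∀ u → f u ≡ just w → u ≡ v)
  linear-arc {v} {w} fv≡w with f v | fv≡w | Allₚ.tabulate⁻ (allᵇ⇒All _ (List.allFin n) linear) v
  ... | .(just w) | refl | check with Equivalence.to T-∧ check
  ...   | target , rest with Equivalence.to T-∧ rest
  ...     | arcᵥ , unique =
    target , arcᵥ , λ u fu≡w → only-preimage u fu≡w (Allₚ.tabulate⁻ (allᵇ⇒All _ (List.allFin n) unique) u)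

  completion-injective : Injective _≡_ _≡_ (completion f)
  completion-injective {x} {y} eq with f x in fx | f y in fy
  ... | nothing | nothing = eq
  ... | just w  | just w′ = sym (proj₂ (proj₂ (linear-arc fx)) y (trans fy (cong just (sym eq))))
  ... | just w  | nothing = contradiction (subst (T ∘ is-just ∘ f) eq (proj₁ (linear-arc fx))) (subst (T ∘ is-just) fy)
  ... | nothing | just w′ = contradiction (subst (T ∘ is-just ∘ f) (sym eq) (proj₁ (linear-arc fy))) (subst (T ∘ is-just) fx)

  codeOf : Code n
  codeOf = toCode (completion f) completion-injective

  codeOf-cycles : f ≗ nontrivialCycles codeOf
  codeOf-cycles v with f v in fv
  ... | nothing = sym (cong (λ b → if b then nothing else just (perm codeOf v))
                            (dec-true (v ≟ perm codeOf v) (sym (trans (perm-toCode _ _ v) (completion-nothing f fv)))))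
  ... | just w  = sym (trans (cong (λ b → if b then nothing else just (perm codeOf v))
                                   (dec-false (v ≟ perm codeOf v) (λ v≡σv → w≢v (trans (sym σv≡w) (sym v≡σv)))))
                             (cong just σv≡w))
    where
    σv≡w : perm codeOf v ≡ w
    σv≡w = trans (perm-toCode _ _ v) (completion-just f fv)
    w≢v : w ≢ v
    w≢v refl = subst (T ∘ is-just) (loopless S v) (proj₁ (proj₂ (linear-arc fv)))

sumList : ∀ {A : Set} → List A → (A → ℤ) → ℤ
sumList []       F = + 0
sumList (x ∷ xs) F = F x + sumList xs F

sumList-cong : ∀ {A : Set} (xs : List A) {F G : A → ℤ} → (∀ x → F x ≡ G x) → sumList xs F ≡ sumList xs G
sumList-cong []       F≗G = refl
sumList-cong (x ∷ xs) F≗G = cong₂ _+_ (F≗G x) (sumList-cong xs F≗G)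

sumList-zero : ∀ {A : Set} (xs : List A) {F : A → ℤ} → (∀ x → F x ≡ + 0) → sumList xs F ≡ + 0
sumList-zero []       F≗0 = refl
sumList-zero (x ∷ xs) F≗0 = cong₂ _+_ (F≗0 x) (sumList-zero xs F≗0)

sumList-++ : ∀ {A : Set} (xs ys : List A) F → sumList (xs List.++ ys) F ≡ sumList xs F + sumList ys F
sumList-++ []       ys F = sym (ℤₚ.+-identityˡ _)
sumList-++ (x ∷ xs) ys F = trans (cong (λ t → F x + t) (sumList-++ xs ys F)) (sym (ℤₚ.+-assoc (F x) _ _))

sumList-map : ∀ {A B : Set} (h : A → B) xs F → sumList (List.map h xs) F ≡ sumList xs (F ∘ h)
sumList-map h []       F = refl
sumList-map h (x ∷ xs) F = cong (λ t → F (h x) + t) (sumList-map h xs F)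

sumList-concatMap : ∀ {A B : Set} (h : A → List B) xs F → sumList (List.concatMap h xs) F ≡ sumList xs (λ x → sumList (h x) F)
sumList-concatMap h []       F = refl
sumList-concatMap h (x ∷ xs) F =
  trans (sumList-++ (h x) (List.concatMap h xs) F) (cong (λ t → sumList (h x) F + t) (sumList-concatMap h xs F))

sumList-tabulate : ∀ {A : Set} {n} (h : Fin n → A) F → sumList (List.tabulate h) F ≡ sum (F ∘ h)
sumList-tabulate {n = zero}  h F = refl
sumList-tabulate {n = suc n} h F = cong (λ t → F (h zero) + t) (sumList-tabulate (h ∘ suc) F)

sumList-when : ∀ {A : Set} (xs : List A) b (F : A → ℤ) → sumList xs (λ x → when b (F x)) ≡ when b (sumList xs F)
sumList-when xs true  F = refl
sumList-when xs false F = sumList-zero xs (λ _ → refl)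

sumList-∑Code : ∀ {A : Set} {n} (xs : List A) (G : A → Code n → ℤ) →
  sumList xs (λ x → ∑Code (G x)) ≡ ∑Code (λ c → sumList xs (λ x → G x c))
sumList-∑Code {n = n} [] G = sym (∑Code-zero {n} (λ _ → + 0) λ _ → refl)
sumList-∑Code (x ∷ xs) G = trans (cong (λ t → ∑Code (G x) + t) (sumList-∑Code xs G)) (sym (∑Code-distrib-+ (G x) _))

infix 4 _≟ᵐ_
infix 5 _≐_
_≟ᵐ_ : ∀ {n} (x y : Maybe (Fin n)) → Dec (x ≡ y)
_≟ᵐ_ = Maybeₚ.≡-dec _≟_

-- Recursing on m like allMaps does makes consF o f ≐ g unfold to a test on o and one on f.
_≐_ : ∀ {m n} → (Fin m → Maybe (Fin n)) → (Fin m → Maybe (Fin n)) → Bool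
_≐_ {zero}  f g = true
_≐_ {suc m} f g = does (f zero ≟ᵐ g zero) ∧ (f ∘ suc ≐ g ∘ suc)

≐-sound : ∀ {m n} (f g : Fin m → Maybe (Fin n)) → f ≐ g ≡ true → f ≗ g
≐-sound f g eq zero    with f zero ≟ᵐ g zero | eq
... | yes f₀≡g₀ | _ = f₀≡g₀
≐-sound f g eq (suc v) with f zero ≟ᵐ g zero | eq
... | yes _ | eq′ = ≐-sound (f ∘ suc) (g ∘ suc) eq′ v

≐-complete : ∀ {m n} (f g : Fin m → Maybe (Fin n)) → f ≗ g → f ≐ g ≡ true
≐-complete {zero}  f g f≗g = refl
≐-complete {suc m} f g f≗g rewrite dec-true (f zero ≟ᵐ g zero) (f≗g zero) = ≐-complete (f ∘ suc) (g ∘ suc) (f≗g ∘ suc)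

options-unique : ∀ {n} (y : Maybe (Fin n)) x →
  sumList (nothing ∷ List.map just (List.allFin n)) (λ o → when (does (o ≟ᵐ y)) x) ≡ x
options-unique {n} nothing  x =
  trans (cong (λ t → x + t) (trans (sumList-map just (List.allFin n) _) (sumList-zero (List.allFin n) λ _ → refl)))
        (ℤₚ.+-identityʳ x)
options-unique {n} (just w) x = begin
  + 0 + sumList (List.map just (List.allFin n)) (λ o → when (does (o ≟ᵐ just w)) x)
    ≡⟨ ℤₚ.+-identityˡ _ ⟩
  sumList (List.map just (List.allFin n)) (λ o → when (does (o ≟ᵐ just w)) x)
    ≡⟨ sumList-map just (List.allFin n) _ ⟩
  sumList (List.allFin n) (λ j → when (does (j ≟ w)) x)
    ≡⟨ sumList-tabulate id (λ j → when (does (j ≟ w)) x) ⟩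
  sum (λ j → when (does (j ≟ w)) x)
    ≡⟨ sum-single _ w (λ j j≢w → cong (λ b → when b x) (dec-false (j ≟ w) j≢w)) ⟩
  when (does (w ≟ w)) x
    ≡⟨ cong (λ b → when b x) (dec-true (w ≟ w) refl) ⟩
  x ∎
  where open ≡-Reasoning

allMaps-unique : ∀ m n (g : Fin m → Maybe (Fin n)) x → sumList (allMaps m n) (λ f → when (f ≐ g) x) ≡ x
allMaps-unique zero    n g x = ℤₚ.+-identityʳ x
allMaps-unique (suc m) n g x = begin
  sumList (allMaps (suc m) n) (λ f → when (f ≐ g) x)
    ≡⟨ sumList-concatMap (λ o → List.map (consF o) (allMaps m n)) options _ ⟩
  sumList options (λ o → sumList (List.map (consF o) (allMaps m n)) (λ f → when (f ≐ g) x))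
    ≡⟨ sumList-cong options (λ o → sumList-map (consF o) (allMaps m n) _) ⟩
  sumList options (λ o → sumList (allMaps m n) (λ f → when (does (o ≟ᵐ g zero) ∧ (f ≐ g ∘ suc)) x))
    ≡⟨ sumList-cong options (λ o → sumList-cong (allMaps m n) λ f → when-∧ (does (o ≟ᵐ g zero)) (f ≐ g ∘ suc) x) ⟩
  sumList options (λ o → sumList (allMaps m n) (λ f → when (does (o ≟ᵐ g zero)) (when (f ≐ g ∘ suc) x)))
    ≡⟨ sumList-cong options (λ o → trans (sumList-when (allMaps m n) (does (o ≟ᵐ g zero)) (λ f → when (f ≐ g ∘ suc) x))
                                       (cong (when (does (o ≟ᵐ g zero))) (allMaps-unique m n (g ∘ suc) x))) ⟩
  sumList options (λ o → when (does (o ≟ᵐ g zero)) x)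
    ≡⟨ options-unique (g zero) x ⟩
  x ∎
  where
  open ≡-Reasoning
  options : List (Maybe (Fin n))
  options = nothing ∷ List.map just (List.allFin n)

sumList-allMaps≡∑Code : ∀ {n} (S : SignedDigraph n) (H : PMap n → ℤ) →
  (∀ f → isLinear S f ≡ false → H f ≡ + 0) → (∀ f c → f ≗ nontrivialCycles c → H f ≡ H (nontrivialCycles c)) →
  sumList (allMaps n n) H ≡ ∑Code (λ c → H (nontrivialCycles c))
sumList-allMaps≡∑Code {n} S H H-nonlinear H-cong = begin
  sumList (allMaps n n) H
    ≡⟨ sumList-cong (allMaps n n) split ⟩
  sumList (allMaps n n) (λ f → ∑Code (λ c → when (f ≐ nontrivialCycles c) (H f)))
    ≡⟨ sumList-∑Code (allMaps n n) (λ f c → when (f ≐ nontrivialCycles c) (H f)) ⟩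
  ∑Code (λ c → sumList (allMaps n n) (λ f → when (f ≐ nontrivialCycles c) (H f)))
    ≡⟨ ∑Code-cong (λ c → sumList-cong (allMaps n n) λ f → when-≐ f c) ⟩
  ∑Code (λ c → sumList (allMaps n n) (λ f → when (f ≐ nontrivialCycles c) (H (nontrivialCycles c))))
    ≡⟨ ∑Code-cong (λ c → allMaps-unique n n (nontrivialCycles c) (H (nontrivialCycles c))) ⟩
  ∑Code (λ c → H (nontrivialCycles c)) ∎
  where
  open ≡-Reasoning
  when-≐ : ∀ f c → when (f ≐ nontrivialCycles c) (H f) ≡ when (f ≐ nontrivialCycles c) (H (nontrivialCycles c))
  when-≐ f c with f ≐ nontrivialCycles c in eq
  ... | true  = H-cong f c (≐-sound f (nontrivialCycles c) eq)
  ... | false = refl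
  split : ∀ f → H f ≡ ∑Code (λ c → when (f ≐ nontrivialCycles c) (H f))
  split f with isLinear S f in linear
  ... | false = trans (H-nonlinear f linear) (sym (∑Code-zero _ λ c →
                  trans (cong (when (f ≐ nontrivialCycles c)) (H-nonlinear f linear)) (when-zero (f ≐ nontrivialCycles c))))
  ... | true  = sym (trans (∑Code-single _ c₀ others)
                           (cong (λ b → when b (H f)) (≐-complete f (nontrivialCycles c₀) (codeOf-cycles S {f} lin))))
    where
    lin : T (isLinear S f)
    lin = Equivalence.from T-≡ linear
    c₀ : Code n
    c₀ = codeOf S {f} lin
    others : ∀ c → c ≢ c₀ → when (f ≐ nontrivialCycles c) (H f) ≡ + 0
    others c c≢c₀ with f ≐ nontrivialCycles c in eq
    ... | false = refl
    ... | true  = contradiction (nontrivialCycles-injective c c₀ λ v →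
                    trans (sym (≐-sound f (nontrivialCycles c) eq v)) (codeOf-cycles S {f} lin v)) c≢c₀

-- The coefficients count linear subdigraphs by type

charPoly-sachs : ∀ {n} (S : SignedDigraph n) k → charPoly S k ≡ sumList (allMaps n n) (sachsTerm S k)
charPoly-sachs {n} S k = begin
  charPoly S k
    ≡⟨ charPoly-leibniz S k ⟩
  ∑Code (λ c → codeSign c * (weight S c * monomial (fixCount c) k))
    ≡⟨ ∑Code-cong (leibnizTerm≡sachsTerm S k) ⟩
  ∑Code (λ c → sachsTerm S k (nontrivialCycles c))
    ≡⟨ sym (sumList-allMaps≡∑Code S (sachsTerm S k) nonlinear (λ f c → sachsTerm-cong S k c)) ⟩
  sumList (allMaps n n) (sachsTerm S k) ∎
  where
  open ≡-Reasoning
  nonlinear : ∀ f → isLinear S f ≡ false → sachsTerm S k f ≡ + 0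
  nonlinear f eq = cong (λ b → when (b ∧ (order f ℕ.+ k ≡ᵇ n)) (sachsValue S f)) eq

sachsValue-types : ∀ {n} (S : SignedDigraph n) f →
  sachsValue S f ≡ (if typeA S f ∨ typeB S f then + 1 else - (+ 1))
sachsValue-types S f =
  trans (cong₂ _*_ (-1^-parity (components f)) (signℤ-isNeg (linSign S f))) (by-cases (isOddᵇ (components f)) (isNeg (linSign S f)))
  where
  by-cases : ∀ odd neg → (if odd then - (+ 1) else + 1) * (if neg then - (+ 1) else + 1)
                          ≡ (if (odd ∧ neg) ∨ (not odd ∧ not neg) then + 1 else - (+ 1))
  by-cases true  true  = refl
  by-cases true  false = refl
  by-cases false true  = refl
  by-cases false false = refl

typeCD≡not-typeAB : ∀ {n} (S : SignedDigraph n) f → (typeC S f ∨ typeD S f) ≡ not (typeA S f ∨ typeB S f)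
typeCD≡not-typeAB S f = by-cases (isOddᵇ (components f)) (isNeg (linSign S f))
  where
  by-cases : ∀ odd neg → ((odd ∧ not neg) ∨ (not odd ∧ neg)) ≡ not ((odd ∧ neg) ∨ (not odd ∧ not neg))
  by-cases true  true  = refl
  by-cases true  false = refl
  by-cases false true  = refl
  by-cases false false = refl

count-difference : ∀ {A : Set} (xs : List A) (a b Q R : A → Bool) → (∀ x → R x ≡ not (Q x)) →
  sumList xs (λ x → when (a x ∧ b x) (if Q x then + 1 else - (+ 1)))
    ≡ + List.length (List.filterᵇ (λ x → a x ∧ b x ∧ Q x) xs) - + List.length (List.filterᵇ (λ x → a x ∧ b x ∧ R x) xs)
count-difference []       a b Q R R≗¬Q = refl
count-difference (x ∷ xs) a b Q R R≗¬Q with a x | b x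
... | false | _     = trans (ℤₚ.+-identityˡ _) (count-difference xs a b Q R R≗¬Q)
... | true  | false = trans (ℤₚ.+-identityˡ _) (count-difference xs a b Q R R≗¬Q)
... | true  | true  rewrite R≗¬Q x with Q x
...   | true  = trans (cong (λ t → + 1 + t) (count-difference xs a b Q R R≗¬Q))
                      (solve 2 (λ p q → con (+ 1) :+ (p :- q) := (con (+ 1) :+ p) :- q) refl
                             (+ List.length (List.filterᵇ (λ x → a x ∧ b x ∧ Q x) xs))
                             (+ List.length (List.filterᵇ (λ x → a x ∧ b x ∧ R x) xs)))
...   | false = trans (cong (λ t → - (+ 1) + t) (count-difference xs a b Q R R≗¬Q))
                      (solve 2 (λ p q → :- con (+ 1) :+ (p :- q) := p :- (con (+ 1) :+ q)) refl
                             (+ List.length (List.filterᵇ (λ x → a x ∧ b x ∧ Q x) xs))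
                             (+ List.length (List.filterᵇ (λ x → a x ∧ b x ∧ R x) xs)))

charPoly-counts : ∀ {n} (S : SignedDigraph n) j k → j ℕ.+ k ≡ n →
  charPoly S k ≡ + countLinear S j (λ f → typeA S f ∨ typeB S f) - + countLinear S j (λ f → typeC S f ∨ typeD S f)
charPoly-counts {n} S j k j+k≡n = begin
  charPoly S k
    ≡⟨ charPoly-sachs S k ⟩
  sumList (allMaps n n) (sachsTerm S k)
    ≡⟨ sumList-cong (allMaps n n) (λ f → cong₂ (λ b v → when (isLinear S f ∧ b) v)
                                                (≡ᵇ-+-cancel (order f) j+k≡n) (sachsValue-types S f)) ⟩
  sumList (allMaps n n) (λ f → when (isLinear S f ∧ (order f ≡ᵇ j)) (if typeA S f ∨ typeB S f then + 1 else - (+ 1)))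
    ≡⟨ count-difference (allMaps n n) (isLinear S) (λ f → order f ≡ᵇ j) _ _ (typeCD≡not-typeAB S) ⟩
  + countLinear S j (λ f → typeA S f ∨ typeB S f) - + countLinear S j (λ f → typeC S f ∨ typeD S f) ∎
  where open ≡-Reasoning

countLinear-beyond : ∀ {n} (S : SignedDigraph n) {j} P → n < j → countLinear S j P ≡ 0
countLinear-beyond {n} S {j} P n<j = none (allMaps n n)
  where
  order≢j : ∀ f → (order f ≡ᵇ j) ≡ false
  order≢j f = ¬T⇒≡false λ t → ℕₚ.<-irrefl (ℕₚ.≡ᵇ⇒≡ (order f) j t)
    (ℕₚ.≤-<-trans (subst (_≤ n) (sym (countV≡count (λ v → is-just (f v)))) (count≤ _)) n<j)
  none : ∀ fs → List.length (List.filterᵇ (λ f → isLinear S f ∧ (order f ≡ᵇ j) ∧ P f) fs) ≡ 0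
  none []       = refl
  none (f ∷ fs) rewrite order≢j f | Boolₚ.∧-zeroʳ (isLinear S f) = none fs

charPoly-beyond : ∀ {n} (S : SignedDigraph n) {k} → n < k → charPoly S k ≡ + 0
charPoly-beyond {n} S {k} n<k = trans (charPoly-sachs S k) (sumList-zero (allMaps n n) vanishes)
  where
  vanishes : ∀ f → sachsTerm S k f ≡ + 0
  vanishes f rewrite ¬T⇒≡false (λ t →
                      ℕₚ.<-irrefl (sym (ℕₚ.≡ᵇ⇒≡ (order f ℕ.+ k) n t)) (ℕₚ.<-≤-trans n<k (ℕₚ.m≤n+m k (order f))))
                   | Boolₚ.∧-zeroʳ (isLinear S f) = refl

cospectral⇒CondIII : ∀ {n} (S : SignedDigraph n) → Cospectral S (negSD S) → CondIII S
cospectral⇒CondIII {n} S cospectral j odd with j ℕ.≤? n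
... | no  j≰n = trans (countLinear-beyond S _ (ℕₚ.≰⇒> j≰n)) (sym (countLinear-beyond S _ (ℕₚ.≰⇒> j≰n)))
... | yes j≤n = ℤₚ.+-injective (ℤₚ.i-j≡0⇒i≡j _ _ (trans (sym (charPoly-counts S j k j+k≡n)) χₖ≡0))
  where
  k : ℕ
  k = n ∸ j
  j+k≡n : j ℕ.+ k ≡ n
  j+k≡n = ℕₚ.m+[n∸m]≡n j≤n
  χₖ≡0 : charPoly S k ≡ + 0
  χₖ≡0 = x≡-x⇒x≡0 _ (begin
    charPoly S k                ≡⟨ cospectral k ⟩
    charPoly (negSD S) k        ≡⟨ charPoly-negSD-split S j k j+k≡n ⟩
    -1^ j * charPoly S k        ≡⟨ cong (_* charPoly S k) (-1^-odd j odd) ⟩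
    - (+ 1) * charPoly S k      ≡⟨ ℤₚ.-1*i≡-i _ ⟩
    - charPoly S k              ∎)
    where open ≡-Reasoning

CondIII⇒cospectral : ∀ {n} (S : SignedDigraph n) → CondIII S → Cospectral S (negSD S)
CondIII⇒cospectral {n} S condIII k with k ℕ.≤? n
... | no  k≰n = trans (charPoly-beyond S (ℕₚ.≰⇒> k≰n)) (sym (charPoly-beyond (negSD S) (ℕₚ.≰⇒> k≰n)))
... | yes k≤n = by-parity (j ℕ.% 2 ℕ.≟ 1)
  where
  open ≡-Reasoning
  j : ℕ
  j = n ∸ k
  j+k≡n : j ℕ.+ k ≡ n
  j+k≡n = ℕₚ.m∸n+n≡m k≤n
  by-parity : Dec (j ℕ.% 2 ≡ 1) → charPoly S k ≡ charPoly (negSD S) k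
  by-parity (yes odd) = begin
    charPoly S k                 ≡⟨ χₖ≡0 ⟩
    + 0                          ≡⟨ sym (ℤₚ.*-zeroʳ (-1^ j)) ⟩
    -1^ j * + 0                  ≡⟨ cong (-1^ j *_) (sym χₖ≡0) ⟩
    -1^ j * charPoly S k         ≡⟨ sym (charPoly-negSD-split S j k j+k≡n) ⟩
    charPoly (negSD S) k         ∎
    where
    χₖ≡0 : charPoly S k ≡ + 0
    χₖ≡0 = trans (charPoly-counts S j k j+k≡n)
                 (trans (cong (λ t → + countLinear S j (λ f → typeA S f ∨ typeB S f) - + t) (sym (condIII j odd)))
                        (ℤₚ.+-inverseʳ (+ countLinear S j (λ f → typeA S f ∨ typeB S f))))
  by-parity (no even) = begin
    charPoly S k                 ≡⟨ sym (ℤₚ.*-identityˡ _) ⟩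
    + 1 * charPoly S k           ≡⟨ cong (_* charPoly S k) (sym (-1^-even j even)) ⟩
    -1^ j * charPoly S k         ≡⟨ sym (charPoly-negSD-split S j k j+k≡n) ⟩
    charPoly (negSD S) k         ∎

theorem2p3 : (n : ℕ) (S : SignedDigraph n) →
    (SpectrumSymmetric S ⇔ Cospectral S (negSD S)) × (Cospectral S (negSD S) ⇔ CondIII S)
theorem2p3 n S =
  mk⇔ (λ symmetric k → trans (symmetric k) (sym (charPoly-negSD S k)))
      (λ cospectral k → trans (cospectral k) (charPoly-negSD S k)) ,
  mk⇔ (cospectral⇒CondIII S) (CondIII⇒cospectral S)
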